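{- Let $r$ be a positive integer, $G$ a chordal graph, and $(T,(X_t)_{t\in V(T)})$ a tree decomposition of $G$ with the properties listed in the context, and let ${\cal R}_t$ ($t\in V(T)$) be as defined in the context. Then: (a) If $t$ is a leaf of $T$, then ${\cal R}_t=\{(\emptyset,\emptyset,0)\}$. (b) If $t$ is an introduce node with child $t'$ and $\{x\}=X_t\setminus X_{t'}$, then $(S,N,k)\in{\cal R}_t$ if and only if either $(S,N,k)\in{\cal R}_{t'}$, or $(S,N,k)=(S'\cup\{x\},N,k)$ for some $(S',N,k)\in{\cal R}_{t'}$ with $|S'|\leq r$. (c) If $t$ is a forget node with child $t'$ and $\{x\}=X_{t'}\setminus X_t$, then $(S,N,k)\in{\cal R}_t$ if and only if either $(S,N,k)\in{\cal R}_{t'}$ and $x\notin S$; or $(S,N,k)=(S'\setminus\{x\},N'\cup\{y\},k'+1)$ for some $(S',N',k')\in{\cal R}_{t'}$ with $x\in S'\setminus N'$ and some $y\in S'\setminus(N'\cup\{x\})$; or $(S,N,k)=(S'\setminus\{x\},N'\setminus\{x\},k')$ for some $(S',N',k')\in{\cal R}_{t'}$ with $x\in N'$. (d) If $t$ is a join node with children $t'$ and $t''$, then $(S,N,k)\in{\cal R}_t$ if and only if $(S,N,k)=(S,N'\cup N'',k'+k'')$ for some $(S,N',k')\in{\cal R}_{t'}$ and $(S,N'',k'')\in{\cal R}_{t''}$ with $N'\cap N''=\emptyset$.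
   Context: All graphs are finite, simple and undirected; $G$ is chordal (no induced cycle of length at least $4$). A graph is $r$-degenerate if every subgraph of order at least one has a vertex of degree at most $r$. For a matching $M$, $V(M)$ is the set of vertices incident with an edge of $M$. $(T,(X_t)_{t\in V(T)})$ is a tree decomposition of $G$ (i.e. every vertex and every edge of $G$ is contained in some bag $X_t$, and for each vertex the nodes whose bags contain it form a subtree of $T$) such that: every bag $X_t$ is a clique of $G$; $T$ is a rooted binary tree; $X_t=\emptyset$ if $t$ is the root or a leaf; if a node $t$ has two children $t',t''$ then $X_t=X_{t'}=X_{t''}$ ($t$ is a join node); if a node $t$ has exactly one child $t'$ then either $|X_t\setminus X_{t'}|=1$ and $X_{t'}\subseteq X_t$ ($t$ is an introduce node) or $|X_{t'}\setminus X_t|=1$ and $X_t\subseteq X_{t'}$ ($t$ is a forget node). For a node $t$, $G_t$ denotes the subgraph of $G$ induced by the union of the bags $X_s$ over all $s$ in the subtree of $T$ rooted at $t$ (consisting of $t$ and its descendants). $\binom{X_t}{2}$ denotes the set of all pairs of vertices of $X_t$. For every node $t$, ${\cal R}_t$ is the set of all triples $(S,N,k)$ such that $N\subseteq S\subseteq X_t$ and there exists a matching $M\subseteq E(G_t)\setminus\binom{X_t}{2}$ with $k=|M|$, $N=V(M)\cap X_t$, and $G[V(M)\cup S]$ $r$-degenerate. -}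

module Defs where

open import Data.Nat using (ℕ; zero; suc; _+_; _≤_; _%_)
open import Data.Bool using (Bool; true; false; T)
open import Data.Fin using (Fin; toℕ)
open import Data.Fin.Subset
  using (Subset; ⁅_⁆; _∈_; _∉_; _⊆_; _∩_; _∪_; _─_; ∣_∣; Nonempty)
  renaming (⊥ to ∅)
open import Data.Product using (Σ; ∃; ∃-syntax; _×_; _,_)
open import Data.Sum using (_⊎_)
open import Data.List using (List; []; _∷_; length)
open import Data.List.Relation.Unary.All using (All)
open import Data.List.Relation.Unary.AllPairs using (AllPairs)
open import Relation.Nullary using (¬_)
open import Relation.Binary.PropositionalEquality using (_≡_; _≢_)
open import Function.Bundles using (_⇔_)
open import Function.Definitions using (Injective)

record Graph (n : ℕ) : Set where
  field
    adj    : Fin n → Fin n → Bool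
    sym    : ∀ u v → adj u v ≡ adj v u
    irrefl : ∀ v → adj v v ≡ false

module _ {n : ℕ} (G : Graph n) where
  open Graph G

  Adj : Fin n → Fin n → Set
  Adj u v = T (adj u v)

  InducedCycle : (m : ℕ) → (Fin (suc (suc (suc (suc m)))) → Fin n) → Set
  InducedCycle m f =
    Injective _≡_ _≡_ f ×
    (∀ i j → Adj (f i) (f j) ⇔
       ((suc (toℕ i) % suc (suc (suc (suc m))) ≡ toℕ j) ⊎
        (suc (toℕ j) % suc (suc (suc (suc m))) ≡ toℕ i)))

  Chordal : Set
  Chordal = ∀ m f → ¬ InducedCycle m f

  Clique : Subset n → Set
  Clique X = ∀ u v → u ∈ X → v ∈ X → u ≢ v → Adj u v

  -- (B , F) is a subgraph of G[A]: vertex set B ⊆ A, edge set F (symmetric)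
  -- consisting of edges of G with both ends in B.
  IsSubgraphOf : Subset n → Subset n → (Fin n → Fin n → Bool) → Set
  IsSubgraphOf A B F =
    B ⊆ A × (∀ u v → F u v ≡ F v u) ×
    (∀ u v → T (F u v) → u ∈ B × v ∈ B × Adj u v)

  nbr : (Fin n → Fin n → Bool) → Fin n → Subset n
  nbr F v = Data.Vec.tabulate (F v)
    where import Data.Vec

  Degenerate : ℕ → Subset n → Set
  Degenerate r A = ∀ B F → IsSubgraphOf A B F → Nonempty B →
    ∃[ v ] (v ∈ B × ∣ nbr F v ∣ ≤ r)

data BTree (n : ℕ) : Set where
  node0 : Subset n → BTree n
  node1 : Subset n → BTree n → BTree n
  node2 : Subset n → BTree n → BTree n → BTree n

bag : ∀ {n} → BTree n → Subset n
bag (node0 X)     = X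
bag (node1 X _)   = X
bag (node2 X _ _) = X

data Pos {n : ℕ} : BTree n → Set where
  here : ∀ {t} → Pos t
  in1  : ∀ {X t} → Pos t → Pos (node1 X t)
  inL  : ∀ {X l r} → Pos l → Pos (node2 X l r)
  inR  : ∀ {X l r} → Pos r → Pos (node2 X l r)

sub : ∀ {n} (t : BTree n) → Pos t → BTree n
sub t here             = t
sub (node1 _ t) (in1 p)   = sub t p
sub (node2 _ l _) (inL p) = sub l p
sub (node2 _ _ r) (inR p) = sub r p

bagAt : ∀ {n} (t : BTree n) → Pos t → Subset n
bagAt t p = bag (sub t p)

-- p ▷ q : q is a child of p
data _▷_ {n : ℕ} : {t : BTree n} → Pos t → Pos t → Set where
  h1 : ∀ {X t} → here {t = node1 X t} ▷ in1 here
  hL : ∀ {X l r} → here {t = node2 X l r} ▷ inL here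
  hR : ∀ {X l r} → here {t = node2 X l r} ▷ inR here
  s1 : ∀ {X t} {p q : Pos t} → p ▷ q → in1 {X = X} p ▷ in1 q
  sL : ∀ {X l r} {p q : Pos l} → p ▷ q → inL {X = X} {r = r} p ▷ inL q
  sR : ∀ {X l r} {p q : Pos r} → p ▷ q → inR {X = X} {l = l} p ▷ inR q

data Walk {n : ℕ} {t : BTree n} (P : Pos t → Set) : Pos t → Pos t → Set where
  stay : ∀ {p} → P p → Walk P p p
  step : ∀ {p q s} → P p → (p ▷ q ⊎ q ▷ p) → Walk P q s → Walk P p s

module _ {n : ℕ} (G : Graph n) where

  IsTreeDecomposition : BTree n → Set
  IsTreeDecomposition T =
    (∀ v → ∃[ p ] v ∈ bagAt T p) ×
    (∀ u v → Adj G u v → ∃[ p ] (u ∈ bagAt T p × v ∈ bagAt T p)) ×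
    (∀ v (p q : Pos T) → v ∈ bagAt T p → v ∈ bagAt T q →
       Walk (λ s → v ∈ bagAt T s) p q)

  NodeOK : BTree n → Set
  NodeOK (node0 X)     = X ≡ ∅
  NodeOK (node1 X t')  =
    (bag t' ⊆ X × ∣ X ─ bag t' ∣ ≡ 1) ⊎ (X ⊆ bag t' × ∣ bag t' ─ X ∣ ≡ 1)
  NodeOK (node2 X l r) = X ≡ bag l × X ≡ bag r

  NiceCliqueDecomposition : BTree n → Set
  NiceCliqueDecomposition T =
    IsTreeDecomposition T ×
    (∀ p → Clique G (bagAt T p)) ×
    bag T ≡ ∅ ×
    (∀ p → NodeOK (sub T p))

  -- V(G_t): union of the bags in the subtree t
  VG : BTree n → Fin n → Set
  VG t v = ∃[ q ] v ∈ bagAt t q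

  -- matchings, given as lists of edges (u , v)
  Edge : Set
  Edge = Fin n × Fin n

  VDisjoint : Edge → Edge → Set
  VDisjoint (a , b) (c , d) = a ≢ c × a ≢ d × b ≢ c × b ≢ d

  verts : List Edge → Subset n
  verts []            = ∅
  verts ((a , b) ∷ M) = ⁅ a ⁆ ∪ ⁅ b ⁆ ∪ verts M

  -- an edge of G_t not in binom(X_t, 2)
  GoodEdge : BTree n → Edge → Set
  GoodEdge t (a , b) =
    Adj G a b × VG t a × VG t b × ¬ (a ∈ bag t × b ∈ bag t)

  IsMatchingIn : BTree n → List Edge → Set
  IsMatchingIn t M = AllPairs VDisjoint M × All (GoodEdge t) M

  InR : ℕ → BTree n → Subset n → Subset n → ℕ → Set
  InR r t S N k =
    N ⊆ S × S ⊆ bag t ×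
    ∃[ M ] (IsMatchingIn t M × k ≡ length M × N ≡ verts M ∩ bag t ×
            Degenerate G r (verts M ∪ S))

module Submission where

-- Its graph-theoretic input is twofold: the separation
-- property of tree decompositions (a vertex occurring inside and outside the
-- subtree of a node c lies in the bags of c and of its parent), and the perfect
-- elimination property of graphs with a clique tree decomposition, from which
-- r-degeneracy of G[A] follows as soon as every clique of G[A] has at most
-- r + 1 vertices (small-cliques⇒degenerate).  The theorem collects the four.

open import Defs
open import Data.Nat using (ℕ; zero; suc; _+_; _≤_)
open import Data.Nat.Properties using (≤-trans; ≤-reflexive; suc-injective; +-suc)
open import Data.Bool using (Bool; true; false) renaming (T to IsTrue)
open import Data.Fin using (Fin; zero; suc; _≟_)
open import Data.Fin.Properties using (¬∀⟶∃¬)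
open import Data.Fin.Subset using (Subset; inside; outside; ⁅_⁆; _∈_; _∉_; _⊆_; _∩_; _∪_; _─_; ∣_∣) renaming (⊥ to ∅)
open import Data.Fin.Subset.Properties using (_∈?_; _⊆?_; ∉⊥; x∈⁅x⁆; x∈⁅y⁆⇒x≡y; x≢y⇒x∉⁅y⁆; x∈p∪q⁺; x∈p∪q⁻; x∈p∩q⁺; x∈p∩q⁻; x∈p∧x∉q⇒x∈p─q; p─⊥≡p; ⊆-antisym; p⊆q⇒∣p∣≤∣q∣; ∩-zeroˡ; ∪-assoc)
open import Data.Vec using (_∷_; here; there; tabulate)
open import Data.Vec.Properties using ([]=⇒lookup; lookup⇒[]=; lookup∘tabulate)
open import Data.List using (List; []; _∷_; length; _++_)
open import Data.List.Properties using (length-++)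
open import Data.List.Relation.Unary.All as All using (All; []; _∷_)
import Data.List.Relation.Unary.All.Properties as AllProps
open import Data.List.Relation.Unary.AllPairs using (AllPairs; []; _∷_)
import Data.List.Relation.Unary.AllPairs.Properties as AllPairsProps
open import Data.List.Relation.Unary.Any using (here; there)
open import Data.List.Membership.Propositional using () renaming (_∈_ to _∈ₗ_)
open import Data.List.Membership.Propositional.Properties using (∈-++⁺ˡ; ∈-++⁺ʳ; ∈-++⁻)
open import Data.Product using (∃-syntax; _×_; _,_; proj₁; proj₂)
open import Data.Sum using (_⊎_; inj₁; inj₂; [_,_]′)
import Data.Sum
open import Data.Empty using (⊥; ⊥-elim)
open import Relation.Nullary using (¬_; yes; no; Dec)
open import Relation.Nullary.Decidable using (_→-dec_)
open import Function using (_∘_)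
open import Function.Bundles using (_⇔_; mk⇔)
open import Relation.Binary.PropositionalEquality using (_≡_; _≢_; refl; sym; trans; cong; cong₂; subst)

private variable
  n : ℕ
  Y Z : Subset n
  u v : Fin n

∪ˡ : v ∈ Y → v ∈ Y ∪ Z
∪ˡ m = x∈p∪q⁺ (inj₁ m)

∪ʳ : v ∈ Z → v ∈ Y ∪ Z
∪ʳ m = x∈p∪q⁺ (inj₂ m)

∪⁻ : v ∈ Y ∪ Z → v ∈ Y ⊎ v ∈ Z
∪⁻ {Y = Y} {Z = Z} = x∈p∪q⁻ Y Z

∩⁺ : v ∈ Y → v ∈ Z → v ∈ Y ∩ Z
∩⁺ a b = x∈p∩q⁺ (a , b)

∩⁻ : v ∈ Y ∩ Z → v ∈ Y × v ∈ Z
∩⁻ {Y = Y} {Z = Z} = x∈p∩q⁻ Y Z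

─⁺ : v ∈ Y → v ∉ Z → v ∈ Y ─ Z
─⁺ = x∈p∧x∉q⇒x∈p─q

─⁻ : v ∈ Y ─ Z → v ∈ Y × v ∉ Z
─⁻ {Y = inside ∷ Y} {Z = outside ∷ Z} here = here , λ ()
─⁻ {v = zero} {Y = outside ∷ _} {Z = outside ∷ _} ()
─⁻ {v = zero} {Y = _ ∷ _} {Z = inside ∷ _} ()
─⁻ {Y = _ ∷ Y} {Z = _ ∷ Z} (there m) with ─⁻ {Y = Y} {Z = Z} m
... | a , b = there a , λ { (there z) → b z }

⁅⁆⁻ : v ∈ ⁅ u ⁆ → v ≡ u
⁅⁆⁻ {u = u} = x∈⁅y⁆⇒x≡y u

∉⁅⁆ : v ≢ u → v ∉ ⁅ u ⁆
∉⁅⁆ = x≢y⇒x∉⁅y⁆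

≡∈ : Y ≡ Z → v ∈ Y → v ∈ Z
≡∈ refl m = m

ext : (∀ {v} → v ∈ Y → v ∈ Z) → (∀ {v} → v ∈ Z → v ∈ Y) → Y ≡ Z
ext = ⊆-antisym

∣─⁅⁆∣ : ∀ (Y : Subset n) → v ∈ Y → suc ∣ Y ─ ⁅ v ⁆ ∣ ≡ ∣ Y ∣
∣─⁅⁆∣ {v = zero}  (inside ∷ Y)  here      = cong suc (cong ∣_∣ (p─⊥≡p Y))
∣─⁅⁆∣ {v = suc v} (inside ∷ Y)  (there m) = cong suc (∣─⁅⁆∣ Y m)
∣─⁅⁆∣ {v = suc v} (outside ∷ Y) (there m) = ∣─⁅⁆∣ Y m

─⁅⁆∪⁅⁆ : v ∈ Y → (Y ─ ⁅ v ⁆) ∪ ⁅ v ⁆ ≡ Y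
─⁅⁆∪⁅⁆ {v = v} {Y = Y} v∈Y = ext forth (λ {u} → back u)
  where
  forth : ∀ {u} → u ∈ (Y ─ ⁅ v ⁆) ∪ ⁅ v ⁆ → u ∈ Y
  forth m = [ (λ z → proj₁ (─⁻ z)) , (λ z → subst (_∈ Y) (sym (⁅⁆⁻ z)) v∈Y) ]′ (∪⁻ m)
  back : ∀ u → u ∈ Y → u ∈ (Y ─ ⁅ v ⁆) ∪ ⁅ v ⁆
  back u m with u ≟ v
  ... | yes refl = ∪ʳ (x∈⁅x⁆ v)
  ... | no u≢v   = ∪ˡ (─⁺ m (∉⁅⁆ u≢v))

∪⁅⁆─⁅⁆ : v ∉ Y → (Y ∪ ⁅ v ⁆) ─ ⁅ v ⁆ ≡ Y
∪⁅⁆─⁅⁆ v∉Y = ext (λ m → let (u , u∉v) = ─⁻ m in [ (λ z → z) , (λ z → ⊥-elim (u∉v z)) ]′ (∪⁻ u))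
                 (λ m → ─⁺ (∪ˡ m) (∉⁅⁆ λ { refl → v∉Y m }))

⊆-or-witness : ∀ (Y Z : Subset n) → Y ⊆ Z ⊎ ∃[ v ] (v ∈ Y × v ∉ Z)
⊆-or-witness {n} Y Z with Y ⊆? Z
... | yes Y⊆Z = inj₁ Y⊆Z
... | no Y⊈Z with ¬∀⟶∃¬ n (λ v → v ∈ Y → v ∈ Z) (λ v → (v ∈? Y) →-dec (v ∈? Z)) (λ h → Y⊈Z (h _))
...   | v , ¬[v∈Y⇒v∈Z] with v ∈? Y
...     | yes v∈Y = inj₂ (v , v∈Y , λ v∈Z → ¬[v∈Y⇒v∈Z] (λ _ → v∈Z))
...     | no v∉Y  = ⊥-elim (¬[v∈Y⇒v∈Z] (λ v∈Y → ⊥-elim (v∉Y v∈Y)))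

private variable
  t : BTree n
  p q s c : Pos t

-- p ≼ s : the node s lies in the subtree rooted at p
infix 4 _≼_
data _≼_ {n : ℕ} : {t : BTree n} → Pos t → Pos t → Set where
  ≼-here : {s : Pos t} → here ≼ s
  ≼-in1  : ∀ {X} {p s : Pos t} → p ≼ s → in1 {X = X} p ≼ in1 s
  ≼-inL  : ∀ {X} {l r : BTree n} {p s : Pos l} → p ≼ s → inL {X = X} {r = r} p ≼ inL s
  ≼-inR  : ∀ {X} {l r : BTree n} {p s : Pos r} → p ≼ s → inR {X = X} {l = l} p ≼ inR s

≼-refl : p ≼ p
≼-refl {p = here}  = ≼-here
≼-refl {p = in1 p} = ≼-in1 ≼-refl
≼-refl {p = inL p} = ≼-inL ≼-refl
≼-refl {p = inR p} = ≼-inR ≼-refl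

≼-trans : p ≼ q → q ≼ s → p ≼ s
≼-trans ≼-here    _         = ≼-here
≼-trans (≼-in1 a) (≼-in1 b) = ≼-in1 (≼-trans a b)
≼-trans (≼-inL a) (≼-inL b) = ≼-inL (≼-trans a b)
≼-trans (≼-inR a) (≼-inR b) = ≼-inR (≼-trans a b)

_≼?_ : (p s : Pos t) → Dec (p ≼ s)
here  ≼? s     = yes ≼-here
in1 p ≼? here  = no λ ()
in1 p ≼? in1 s with p ≼? s
... | yes a = yes (≼-in1 a)
... | no ¬a = no λ { (≼-in1 a) → ¬a a }
inL p ≼? here  = no λ ()
inL p ≼? inL s with p ≼? s
... | yes a = yes (≼-inL a)
... | no ¬a = no λ { (≼-inL a) → ¬a a }
inL p ≼? inR s = no λ ()
inR p ≼? here  = no λ ()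
inR p ≼? inL s = no λ ()
inR p ≼? inR s with p ≼? s
... | yes a = yes (≼-inR a)
... | no ¬a = no λ { (≼-inR a) → ¬a a }

▷-down : s ▷ q → p ≼ s → p ≼ q
▷-down _      ≼-here    = ≼-here
▷-down (s1 e) (≼-in1 a) = ≼-in1 (▷-down e a)
▷-down (sL e) (≼-inL a) = ≼-inL (▷-down e a)
▷-down (sR e) (≼-inR a) = ≼-inR (▷-down e a)

▷⇒≼ : p ▷ c → p ≼ c
▷⇒≼ e = ▷-down e ≼-refl

▷⇒⋡ : p ▷ c → ¬ c ≼ p
▷⇒⋡ (s1 e) (≼-in1 a) = ▷⇒⋡ e a
▷⇒⋡ (sL e) (≼-inL a) = ▷⇒⋡ e a
▷⇒⋡ (sR e) (≼-inR a) = ▷⇒⋡ e a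

▷-up : q ▷ s → p ≼ s → ¬ p ≼ q → p ≡ s
▷-up _      ≼-here         np = ⊥-elim (np ≼-here)
▷-up h1     (≼-in1 ≼-here) _  = refl
▷-up hL     (≼-inL ≼-here) _  = refl
▷-up hR     (≼-inR ≼-here) _  = refl
▷-up (s1 e) (≼-in1 a)      np = cong in1 (▷-up e a (λ z → np (≼-in1 z)))
▷-up (sL e) (≼-inL a)      np = cong inL (▷-up e a (λ z → np (≼-inL z)))
▷-up (sR e) (≼-inR a)      np = cong inR (▷-up e a (λ z → np (≼-inR z)))

▷-parent-unique : q ▷ c → p ▷ c → q ≡ p
▷-parent-unique h1     h1     = refl
▷-parent-unique hL     hL     = refl
▷-parent-unique hR     hR     = refl
▷-parent-unique (s1 a) (s1 b) = cong in1 (▷-parent-unique a b)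
▷-parent-unique (sL a) (sL b) = cong inL (▷-parent-unique a b)
▷-parent-unique (sR a) (sR b) = cong inR (▷-parent-unique a b)

walk-start : ∀ {P : Pos t → Set} → Walk P s q → P s
walk-start (stay x)     = x
walk-start (step x _ _) = x

walk-leaves-through : ∀ {P : Pos t → Set} → Walk P s q → c ≼ s → ¬ c ≼ q → P c
walk-leaves-through (stay _) a b = ⊥-elim (b a)
walk-leaves-through {c = c} (step {q = q} Ps ed w) a b with c ≼? q
... | yes cq = walk-leaves-through w cq b
walk-leaves-through (step Ps (inj₁ sq) w) a b | no ncq = ⊥-elim (ncq (▷-down sq a))
walk-leaves-through {P = P} (step Ps (inj₂ qs) w) a b | no ncq = subst P (sym (▷-up qs a ncq)) Ps

walk-leaves-via-parent : ∀ {P : Pos t → Set} → Walk P s q → c ≼ s → ¬ c ≼ q → p ▷ c → P p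
walk-leaves-via-parent (stay _) a b _ = ⊥-elim (b a)
walk-leaves-via-parent {c = c} (step {q = q} Ps ed w) a b pc with c ≼? q
... | yes cq = walk-leaves-via-parent w cq b pc
walk-leaves-via-parent (step Ps (inj₁ sq) w) a b pc | no ncq = ⊥-elim (ncq (▷-down sq a))
walk-leaves-via-parent {P = P} (step {q = q} Ps (inj₂ qs) w) a b pc | no ncq =
  subst P (▷-parent-unique (subst (q ▷_) (sym (▷-up qs a ncq)) qs) pc) (walk-start w)

leaf-subtree : ∀ {X} (p : Pos t) → sub t p ≡ node0 X → p ≼ s → s ≡ p
leaf-subtree {s = here} here refl ≼-here = refl
leaf-subtree (in1 p) e    (≼-in1 a) = cong in1 (leaf-subtree p e a)
leaf-subtree (inL p) e    (≼-inL a) = cong inL (leaf-subtree p e a)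
leaf-subtree (inR p) e    (≼-inR a) = cong inR (leaf-subtree p e a)

record UnaryChild (u : BTree n) (p : Pos u) (t' : BTree n) : Set where
  field
    child     : Pos u
    sub-child : sub u child ≡ t'
    edge      : p ▷ child
    cover     : ∀ {s} → p ≼ s → s ≡ p ⊎ child ≼ s

unary-child : ∀ {u t' : BTree n} {X} (p : Pos u) → sub u p ≡ node1 X t' → UnaryChild u p t'
unary-child here refl = record
  { child = in1 here ; sub-child = refl ; edge = h1
  ; cover = λ { {here} _ → inj₁ refl ; {in1 s} _ → inj₂ (≼-in1 ≼-here) } }
unary-child (in1 p) e = let module C = UnaryChild (unary-child p e) in record
  { child = in1 C.child ; sub-child = C.sub-child ; edge = s1 C.edge
  ; cover = λ { (≼-in1 a) → Data.Sum.map (cong in1) ≼-in1 (C.cover a) } }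
unary-child (inL p) e = let module C = UnaryChild (unary-child p e) in record
  { child = inL C.child ; sub-child = C.sub-child ; edge = sL C.edge
  ; cover = λ { (≼-inL a) → Data.Sum.map (cong inL) ≼-inL (C.cover a) } }
unary-child (inR p) e = let module C = UnaryChild (unary-child p e) in record
  { child = inR C.child ; sub-child = C.sub-child ; edge = sR C.edge
  ; cover = λ { (≼-inR a) → Data.Sum.map (cong inR) ≼-inR (C.cover a) } }

record BinaryChildren (u : BTree n) (p : Pos u) (l r : BTree n) : Set where
  field
    cL cR    : Pos u
    sub-L    : sub u cL ≡ l
    sub-R    : sub u cR ≡ r
    edgeL    : p ▷ cL
    edgeR    : p ▷ cR
    cover    : ∀ {s} → p ≼ s → s ≡ p ⊎ cL ≼ s ⊎ cR ≼ s
    disjoint : ∀ {s} → cL ≼ s → cR ≼ s → ⊥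

binary-children : ∀ {u l r : BTree n} {X} (p : Pos u) → sub u p ≡ node2 X l r →
  BinaryChildren u p l r
binary-children here refl = record
  { cL = inL here ; cR = inR here ; sub-L = refl ; sub-R = refl ; edgeL = hL ; edgeR = hR
  ; cover = λ { {here} _ → inj₁ refl ; {inL s} _ → inj₂ (inj₁ (≼-inL ≼-here))
              ; {inR s} _ → inj₂ (inj₂ (≼-inR ≼-here)) }
  ; disjoint = λ { {inL s} _ () ; {inR s} () _ } }
binary-children (in1 p) e = let module C = BinaryChildren (binary-children p e) in record
  { cL = in1 C.cL ; cR = in1 C.cR ; sub-L = C.sub-L ; sub-R = C.sub-R
  ; edgeL = s1 C.edgeL ; edgeR = s1 C.edgeR
  ; cover = λ { (≼-in1 a) → Data.Sum.map (cong in1) (Data.Sum.map ≼-in1 ≼-in1) (C.cover a) }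
  ; disjoint = λ { (≼-in1 a) (≼-in1 b) → C.disjoint a b } }
binary-children (inL p) e = let module C = BinaryChildren (binary-children p e) in record
  { cL = inL C.cL ; cR = inL C.cR ; sub-L = C.sub-L ; sub-R = C.sub-R
  ; edgeL = sL C.edgeL ; edgeR = sL C.edgeR
  ; cover = λ { (≼-inL a) → Data.Sum.map (cong inL) (Data.Sum.map ≼-inL ≼-inL) (C.cover a) }
  ; disjoint = λ { (≼-inL a) (≼-inL b) → C.disjoint a b } }
binary-children (inR p) e = let module C = BinaryChildren (binary-children p e) in record
  { cL = inR C.cL ; cR = inR C.cR ; sub-L = C.sub-L ; sub-R = C.sub-R
  ; edgeL = sR C.edgeL ; edgeR = sR C.edgeR
  ; cover = λ { (≼-inR a) → Data.Sum.map (cong inR) (Data.Sum.map ≼-inR ≼-inR) (C.cover a) }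
  ; disjoint = λ { (≼-inR a) (≼-inR b) → C.disjoint a b } }

Occurs : BTree n → Fin n → Set
Occurs t v = ∃[ q ] v ∈ bagAt t q

OccursBelow : (u : BTree n) → Pos u → Fin n → Set
OccursBelow u p v = ∃[ s ] (p ≼ s × v ∈ bagAt u s)

occurs⇒below : ∀ {u t : BTree n} (p : Pos u) → sub u p ≡ t → Occurs t v → OccursBelow u p v
occurs⇒below here    refl (q , m) = q , ≼-here , m
occurs⇒below (in1 p) e    o with occurs⇒below p e o
... | s , a , m = in1 s , ≼-in1 a , m
occurs⇒below (inL p) e    o with occurs⇒below p e o
... | s , a , m = inL s , ≼-inL a , m
occurs⇒below (inR p) e    o with occurs⇒below p e o
... | s , a , m = inR s , ≼-inR a , m

below⇒occurs : ∀ {u t : BTree n} (p : Pos u) → sub u p ≡ t → OccursBelow u p v → Occurs t v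
below⇒occurs here    refl (q , _ , m)           = q , m
below⇒occurs (in1 p) e    (in1 s , ≼-in1 a , m) = below⇒occurs p e (s , a , m)
below⇒occurs (inL p) e    (inL s , ≼-inL a , m) = below⇒occurs p e (s , a , m)
below⇒occurs (inR p) e    (inR s , ≼-inR a , m) = below⇒occurs p e (s , a , m)

occurs-node1 : ∀ {X} {t' : BTree n} → Occurs (node1 X t') v → v ∈ X ⊎ Occurs t' v
occurs-node1 (here  , m) = inj₁ m
occurs-node1 (in1 q , m) = inj₂ (q , m)

occurs-in1 : ∀ {X} {t' : BTree n} → Occurs t' v → Occurs (node1 X t') v
occurs-in1 (q , m) = in1 q , m

occurs-node2 : ∀ {X} {l r : BTree n} → Occurs (node2 X l r) v → v ∈ X ⊎ Occurs l v ⊎ Occurs r v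
occurs-node2 (here  , m) = inj₁ m
occurs-node2 (inL q , m) = inj₂ (inj₁ (q , m))
occurs-node2 (inR q , m) = inj₂ (inj₂ (q , m))

occurs-inL : ∀ {X} {l r : BTree n} → Occurs l v → Occurs (node2 X l r) v
occurs-inL (q , m) = inL q , m

occurs-inR : ∀ {X} {l r : BTree n} → Occurs r v → Occurs (node2 X l r) v
occurs-inR (q , m) = inR q , m

occurs-bag : ∀ {t : BTree n} → v ∈ bag t → Occurs t v
occurs-bag m = here , m

vertices : BTree n → Subset n
vertices (node0 X)     = X
vertices (node1 X t)   = X ∪ vertices t
vertices (node2 X l r) = X ∪ (vertices l ∪ vertices r)

-- Occurs t v is thus decidable
vertices⇒occurs : ∀ (t : BTree n) → v ∈ vertices t → Occurs t v
vertices⇒occurs (node0 X) m = here , m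
vertices⇒occurs (node1 X t) m with ∪⁻ m
... | inj₁ a = here , a
... | inj₂ b = let (q , z) = vertices⇒occurs t b in in1 q , z
vertices⇒occurs (node2 X l r) m with ∪⁻ m
... | inj₁ a = here , a
... | inj₂ b with ∪⁻ b
...   | inj₁ z = let (q , w) = vertices⇒occurs l z in inL q , w
...   | inj₂ z = let (q , w) = vertices⇒occurs r z in inR q , w

occurs⇒vertices : ∀ (t : BTree n) → Occurs t v → v ∈ vertices t
occurs⇒vertices (node0 X)     (here , m)  = m
occurs⇒vertices (node1 X t)   (here , m)  = ∪ˡ m
occurs⇒vertices (node1 X t)   (in1 q , m) = ∪ʳ (occurs⇒vertices t (q , m))
occurs⇒vertices (node2 X l r) (here , m)  = ∪ˡ m
occurs⇒vertices (node2 X l r) (inL q , m) = ∪ʳ (∪ˡ (occurs⇒vertices l (q , m)))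
occurs⇒vertices (node2 X l r) (inR q , m) = ∪ʳ (∪ʳ (occurs⇒vertices r (q , m)))

occurs? : ∀ (t : BTree n) v → Dec (Occurs t v)
occurs? t v with v ∈? vertices t
... | yes m = yes (vertices⇒occurs t m)
... | no ¬m = no λ o → ¬m (occurs⇒vertices t o)

module _ {n : ℕ} (G : Graph n) where

  adj-sym : ∀ {a b} → Adj G a b → Adj G b a
  adj-sym {a} {b} = subst IsTrue (Graph.sym G a b)

  adj-≢ : ∀ {a b} → Adj G a b → a ≢ b
  adj-≢ {a} z refl = subst IsTrue (Graph.irrefl G a) z

  nbr⁻ : ∀ F v w → w ∈ nbr G F v → IsTrue (F v w)
  nbr⁻ F v w m with F v w | trans (sym (lookup∘tabulate (F v) w)) ([]=⇒lookup m)
  ... | true | _ = _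

  nbr⁺ : ∀ F v w → IsTrue (F v w) → w ∈ nbr G F v
  nbr⁺ F v w t = lookup⇒[]= w (tabulate (F v)) (trans (lookup∘tabulate (F v) w) (is-true (F v w) t))
    where
    is-true : ∀ b → IsTrue b → b ≡ true
    is-true true _ = refl

  degenerate-mono : ∀ {r A A'} → A' ⊆ A → Degenerate G r A → Degenerate G r A'
  degenerate-mono A'⊆A d B F (B⊆A' , F-sym , F-edges) = d B F ((λ m → A'⊆A (B⊆A' m)) , F-sym , F-edges)

  clique-mono : ∀ {C C'} → C' ⊆ C → Clique G C → Clique G C'
  clique-mono C'⊆C clique u w mu mw = clique u w (C'⊆C mu) (C'⊆C mw)

  complete : Subset n → Fin n → Fin n → Bool
  complete C u w with u ∈? C | w ∈? C | u ≟ w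
  ... | yes _ | yes _ | no _ = true
  ... | _     | _     | _    = false

  complete-sym : ∀ C u w → complete C u w ≡ complete C w u
  complete-sym C u w with u ∈? C | w ∈? C | u ≟ w | w ≟ u
  ... | yes _ | yes _ | no _  | no _  = refl
  ... | yes _ | yes _ | yes _ | yes _ = refl
  ... | yes _ | yes _ | yes e | no ne = ⊥-elim (ne (sym e))
  ... | yes _ | yes _ | no ne | yes e = ⊥-elim (ne (sym e))
  ... | yes _ | no _  | _     | _     = refl
  ... | no _  | yes _ | _     | _     = refl
  ... | no _  | no _  | _     | _     = refl

  complete⁻ : ∀ C u w → IsTrue (complete C u w) → u ∈ C × w ∈ C × u ≢ w
  complete⁻ C u w t with u ∈? C | w ∈? C | u ≟ w
  ... | yes a | yes b | no ne = a , b , ne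

  complete⁺ : ∀ C u w → u ∈ C → w ∈ C → u ≢ w → IsTrue (complete C u w)
  complete⁺ C u w a b ne with u ∈? C | w ∈? C | u ≟ w
  ... | yes _ | yes _ | no _  = _
  ... | no ¬a | _     | _     = ¬a a
  ... | yes _ | no ¬b | _     = ¬b b
  ... | yes _ | yes _ | yes e = ne e

  clique-subgraph : ∀ {C A} → Clique G C → C ⊆ A → IsSubgraphOf G A C (complete C)
  clique-subgraph {C} clique C⊆A = C⊆A , complete-sym C , edges
    where
    edges : ∀ u w → IsTrue (complete C u w) → u ∈ C × w ∈ C × Adj G u w
    edges u w t = let (a , b , ne) = complete⁻ C u w t in a , b , clique u w a b ne

  -- A clique C inside an r-degenerate set has at most r + 1 vertices: applied to
  -- the clique itself, degeneracy yields a vertex w with |C - w| ≤ r.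
  clique-bound : ∀ {r C A v} → Clique G C → C ⊆ A → Degenerate G r A → v ∈ C →
    ∣ C ─ ⁅ v ⁆ ∣ ≤ r
  clique-bound {C = C} {v = v} clique C⊆A d v∈C with d C (complete C) (clique-subgraph clique C⊆A) (v , v∈C)
  ... | w , w∈C , deg≤r = ≤-trans (≤-reflexive same-size) (≤-trans (p⊆q⇒∣p∣≤∣q∣ C-w⊆nbr) deg≤r)
    where
    same-size : ∣ C ─ ⁅ v ⁆ ∣ ≡ ∣ C ─ ⁅ w ⁆ ∣
    same-size = suc-injective (trans (∣─⁅⁆∣ C v∈C) (sym (∣─⁅⁆∣ C w∈C)))
    C-w⊆nbr : C ─ ⁅ w ⁆ ⊆ nbr G (complete C) w
    C-w⊆nbr {u} m = let (u∈C , u∉w) = ─⁻ m in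
      nbr⁺ (complete C) w u (complete⁺ C w u w∈C u∈C (λ e → u∉w (subst (_∈ ⁅ w ⁆) e (x∈⁅x⁆ w))))

  add-low-degree : ∀ {r A S} x → Degenerate G r A → ∣ S ∣ ≤ r →
    (∀ w → w ∈ A → Adj G x w → w ∈ S) → Degenerate G r (A ∪ ⁅ x ⁆)
  add-low-degree {A = A} {S = S} x d ∣S∣≤r nbrs⊆S B F (B⊆ , F-sym , F-edges) nonempty with x ∈? B
  ... | yes x∈B = x , x∈B , ≤-trans (p⊆q⇒∣p∣≤∣q∣ nbr⊆S) ∣S∣≤r
    where
    nbr⊆S : nbr G F x ⊆ S
    nbr⊆S {w} m with F-edges x w (nbr⁻ F x w m)
    ... | _ , w∈B , adj with ∪⁻ (B⊆ w∈B)
    ...   | inj₁ w∈A = nbrs⊆S w w∈A adj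
    ...   | inj₂ w≡x = ⊥-elim (adj-≢ adj (sym (⁅⁆⁻ w≡x)))
  ... | no x∉B = d B F (B⊆A , F-sym , F-edges) nonempty
    where
    B⊆A : B ⊆ A
    B⊆A m with ∪⁻ (B⊆ m)
    ... | inj₁ a = a
    ... | inj₂ z = ⊥-elim (x∉B (subst (_∈ B) (⁅⁆⁻ z) m))

module _ {n : ℕ} {G : Graph n} where

  verts-cons⁻ : ∀ {v a b} M → v ∈ verts G ((a , b) ∷ M) → (v ≡ a ⊎ v ≡ b) ⊎ v ∈ verts G M
  verts-cons⁻ M m with ∪⁻ m
  ... | inj₁ z = inj₁ (inj₁ (⁅⁆⁻ z))
  ... | inj₂ z = Data.Sum.map₁ (inj₂ ∘ ⁅⁆⁻) (∪⁻ z)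

  verts-fst : ∀ {a b} M → a ∈ verts G ((a , b) ∷ M)
  verts-fst {a} M = ∪ˡ (x∈⁅x⁆ a)

  verts-snd : ∀ {a b} M → b ∈ verts G ((a , b) ∷ M)
  verts-snd {b = b} M = ∪ʳ (∪ˡ (x∈⁅x⁆ b))

  verts-tail : ∀ {v a b} M → v ∈ verts G M → v ∈ verts G ((a , b) ∷ M)
  verts-tail M m = ∪ʳ (∪ʳ m)

  verts⇒edge : ∀ {v} M → v ∈ verts G M → ∃[ e ] (e ∈ₗ M × (v ≡ proj₁ e ⊎ v ≡ proj₂ e))
  verts⇒edge []            m = ⊥-elim (∉⊥ m)
  verts⇒edge ((a , b) ∷ M) m with verts-cons⁻ M m
  ... | inj₁ end = (a , b) , here refl , end
  ... | inj₂ z   = let (e , e∈M , end) = verts⇒edge M z in e , there e∈M , end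

  edge⇒verts : ∀ {e} M → e ∈ₗ M → proj₁ e ∈ verts G M × proj₂ e ∈ verts G M
  edge⇒verts ((a , b) ∷ M) (here refl) = verts-fst M , verts-snd M
  edge⇒verts ((a , b) ∷ M) (there m)   = let (x , y) = edge⇒verts M m in verts-tail M x , verts-tail M y

  end⇒verts : ∀ {v e} M → e ∈ₗ M → v ≡ proj₁ e ⊎ v ≡ proj₂ e → v ∈ verts G M
  end⇒verts M e∈M (inj₁ refl) = proj₁ (edge⇒verts M e∈M)
  end⇒verts M e∈M (inj₂ refl) = proj₂ (edge⇒verts M e∈M)

  verts-mono : ∀ {v} M₁ M₂ → (∀ {e} → e ∈ₗ M₁ → e ∈ₗ M₂) → v ∈ verts G M₁ → v ∈ verts G M₂
  verts-mono M₁ M₂ sub m = let (e , e∈M₁ , end) = verts⇒edge M₁ m in end⇒verts M₂ (sub e∈M₁) end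

  verts-All : ∀ {Q : Edge G → Set} {R : Fin n → Set} → (∀ a b → Q (a , b) → R a × R b) →
    ∀ {v} M → All Q M → v ∈ verts G M → R v
  verts-All ends M qs m with verts⇒edge M m
  ... | (a , b) , e∈M , inj₁ refl = proj₁ (ends a b (All.lookup qs e∈M))
  ... | (a , b) , e∈M , inj₂ refl = proj₂ (ends a b (All.lookup qs e∈M))

  matched-occur : ∀ {t v} M → All (GoodEdge G t) M → v ∈ verts G M → Occurs t v
  matched-occur = verts-All (λ a b (_ , oa , ob , _) → oa , ob)

  disjoint⇒∉verts : ∀ {a b} M → All (VDisjoint G (a , b)) M → a ∉ verts G M × b ∉ verts G M
  disjoint⇒∉verts {a} {b} M ds = (λ m → proj₁ (ends m) refl) , (λ m → proj₂ (ends m) refl)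
    where
    ends : ∀ {v} → v ∈ verts G M → a ≢ v × b ≢ v
    ends = verts-All (λ c d (a≢c , a≢d , b≢c , b≢d) → (a≢c , b≢c) , (a≢d , b≢d)) M ds

  ∉verts⇒disjoint : ∀ {a b} M → a ∉ verts G M → b ∉ verts G M → All (VDisjoint G (a , b)) M
  ∉verts⇒disjoint M a∉M b∉M = All.tabulate λ {e} e∈M →
    let (c∈M , d∈M) = edge⇒verts M e∈M in
    (λ { refl → a∉M c∈M }) , (λ { refl → a∉M d∈M }) , (λ { refl → b∉M c∈M }) , (λ { refl → b∉M d∈M })

  verts-++⁻ : ∀ {v} M₁ M₂ → v ∈ verts G (M₁ ++ M₂) → v ∈ verts G M₁ ⊎ v ∈ verts G M₂
  verts-++⁻ M₁ M₂ m with verts⇒edge (M₁ ++ M₂) m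
  ... | e , e∈M , end = Data.Sum.map (λ z → end⇒verts M₁ z end) (λ z → end⇒verts M₂ z end) (∈-++⁻ M₁ e∈M)

  verts-++ˡ : ∀ {v} M₁ M₂ → v ∈ verts G M₁ → v ∈ verts G (M₁ ++ M₂)
  verts-++ˡ M₁ M₂ = verts-mono M₁ (M₁ ++ M₂) (∈-++⁺ˡ)

  verts-++ʳ : ∀ {v} M₁ M₂ → v ∈ verts G M₂ → v ∈ verts G (M₁ ++ M₂)
  verts-++ʳ M₁ M₂ = verts-mono M₂ (M₁ ++ M₂) (∈-++⁺ʳ M₁)

  record WithoutEdgeAt (x : Fin n) (M : List (Edge G)) : Set where
    field
      y        : Fin n
      M'       : List (Edge G)
      edge∈M   : (x , y) ∈ₗ M ⊎ (y , x) ∈ₗ M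
      M'⊆M     : ∀ {e} → e ∈ₗ M' → e ∈ₗ M
      M⊆       : ∀ {e} → e ∈ₗ M → e ≡ (x , y) ⊎ e ≡ (y , x) ⊎ e ∈ₗ M'
      matching : AllPairs (VDisjoint G) M'
      length≡  : length M ≡ suc (length M')
      x∉M'     : x ∉ verts G M'
      y∉M'     : y ∉ verts G M'

  module _ {x M} (W : WithoutEdgeAt x M) where
    open WithoutEdgeAt W

    verts-without : ∀ {v} → v ∈ verts G M → (v ≡ x ⊎ v ≡ y) ⊎ v ∈ verts G M'
    verts-without m with verts⇒edge M m
    ... | e , e∈M , end with M⊆ e∈M | end
    ...   | inj₁ refl        | inj₁ refl = inj₁ (inj₁ refl)
    ...   | inj₁ refl        | inj₂ refl = inj₁ (inj₂ refl)
    ...   | inj₂ (inj₁ refl) | inj₁ refl = inj₁ (inj₂ refl)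
    ...   | inj₂ (inj₁ refl) | inj₂ refl = inj₁ (inj₁ refl)
    ...   | inj₂ (inj₂ e∈M') | _         = inj₂ (end⇒verts M' e∈M' end)

    x-matched : x ∈ verts G M
    x-matched = [ (λ z → proj₁ (edge⇒verts M z)) , (λ z → proj₂ (edge⇒verts M z)) ]′ edge∈M

    partner-matched : y ∈ verts G M
    partner-matched = [ (λ z → proj₂ (edge⇒verts M z)) , (λ z → proj₁ (edge⇒verts M z)) ]′ edge∈M

    rest-matched : ∀ {v} → v ∈ verts G M' → v ∈ verts G M
    rest-matched = verts-mono M' M M'⊆M

  without-edge-at : ∀ {x} M → AllPairs (VDisjoint G) M → x ∈ verts G M → WithoutEdgeAt x M
  without-edge-at [] [] m = ⊥-elim (∉⊥ m)
  without-edge-at ((a , b) ∷ M) (ds ∷ ap) m with verts-cons⁻ M m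
  ... | inj₁ (inj₁ refl) = record
    { y = b ; M' = M ; edge∈M = inj₁ (here refl) ; M'⊆M = there
    ; M⊆ = λ { (here refl) → inj₁ refl ; (there z) → inj₂ (inj₂ z) }
    ; matching = ap ; length≡ = refl
    ; x∉M' = proj₁ (disjoint⇒∉verts M ds) ; y∉M' = proj₂ (disjoint⇒∉verts M ds) }
  ... | inj₁ (inj₂ refl) = record
    { y = a ; M' = M ; edge∈M = inj₂ (here refl) ; M'⊆M = there
    ; M⊆ = λ { (here refl) → inj₂ (inj₁ refl) ; (there z) → inj₂ (inj₂ z) }
    ; matching = ap ; length≡ = refl
    ; x∉M' = proj₂ (disjoint⇒∉verts M ds) ; y∉M' = proj₁ (disjoint⇒∉verts M ds) }
  ... | inj₂ z = record
    { y = W.y ; M' = (a , b) ∷ W.M'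
    ; edge∈M = Data.Sum.map there there W.edge∈M
    ; M'⊆M = λ { (here refl) → here refl ; (there w) → there (W.M'⊆M w) }
    ; M⊆ = λ { (here refl) → inj₂ (inj₂ (here refl))
             ; (there w) → Data.Sum.map₂ (Data.Sum.map₂ there) (W.M⊆ w) }
    ; matching = All.tabulate (λ w → All.lookup ds (W.M'⊆M w)) ∷ W.matching
    ; length≡ = cong suc W.length≡
    ; x∉M' = not-in-head W.x∉M' first second ; y∉M' = not-in-head W.y∉M' second first }
    where
    module W = WithoutEdgeAt (without-edge-at M ap z)
    disjoint-xy : VDisjoint G (a , b) (_ , W.y) ⊎ VDisjoint G (a , b) (W.y , _)
    disjoint-xy = Data.Sum.map (All.lookup ds) (All.lookup ds) W.edge∈M
    first : ∀ {c d} → VDisjoint G (a , b) (c , d) → a ≢ c × b ≢ c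
    first (a≢c , _ , b≢c , _) = a≢c , b≢c
    second : ∀ {c d} → VDisjoint G (a , b) (c , d) → a ≢ d × b ≢ d
    second (_ , a≢d , _ , b≢d) = a≢d , b≢d
    not-in-head : ∀ {v} → v ∉ verts G W.M' →
      (VDisjoint G (a , b) (_ , W.y) → a ≢ v × b ≢ v) →
      (VDisjoint G (a , b) (W.y , _) → a ≢ v × b ≢ v) →
      v ∉ verts G ((a , b) ∷ W.M')
    not-in-head v∉ dl dr m with verts-cons⁻ W.M' m | [ dl , dr ]′ disjoint-xy
    ... | inj₁ (inj₁ refl) | a≢v , _ = a≢v refl
    ... | inj₁ (inj₂ refl) | _ , b≢v = b≢v refl
    ... | inj₂ w           | _       = v∉ w

  record Partition (P : Edge G → Set) (M : List (Edge G)) : Set where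
    field
      A B       : List (Edge G)
      A⊆M       : ∀ {e} → e ∈ₗ A → e ∈ₗ M
      B⊆M       : ∀ {e} → e ∈ₗ B → e ∈ₗ M
      P-on-A    : ∀ {e} → e ∈ₗ A → P e
      ¬P-on-B   : ∀ {e} → e ∈ₗ B → ¬ P e
      M⊆A∪B     : ∀ {e} → e ∈ₗ M → e ∈ₗ A ⊎ e ∈ₗ B
      length≡   : length M ≡ length A + length B
      matchingA : AllPairs (VDisjoint G) A
      matchingB : AllPairs (VDisjoint G) B
      disjoint  : ∀ {v} → v ∈ verts G A → v ∈ verts G B → ⊥

  partition : ∀ {P : Edge G → Set} → (∀ e → Dec (P e)) → ∀ M → AllPairs (VDisjoint G) M →
    Partition P M
  partition P? [] [] = record
    { A = [] ; B = [] ; A⊆M = λ () ; B⊆M = λ () ; P-on-A = λ () ; ¬P-on-B = λ ()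
    ; M⊆A∪B = λ () ; length≡ = refl ; matchingA = [] ; matchingB = [] ; disjoint = λ m _ → ∉⊥ m }
  partition P? ((a , b) ∷ M) (ds ∷ ap) with P? (a , b)
  ... | yes Pe = record
    { A = (a , b) ∷ S.A ; B = S.B
    ; A⊆M = λ { (here refl) → here refl ; (there z) → there (S.A⊆M z) } ; B⊆M = λ z → there (S.B⊆M z)
    ; P-on-A = λ { (here refl) → Pe ; (there z) → S.P-on-A z } ; ¬P-on-B = S.¬P-on-B
    ; M⊆A∪B = λ { (here refl) → inj₁ (here refl) ; (there z) → Data.Sum.map₁ there (S.M⊆A∪B z) }
    ; length≡ = cong suc S.length≡
    ; matchingA = All.tabulate (λ z → All.lookup ds (S.A⊆M z)) ∷ S.matchingA ; matchingB = S.matchingB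
    ; disjoint = λ m₁ m₂ → [ head∉ (verts-mono S.B M S.B⊆M m₂) , (λ z → S.disjoint z m₂) ]′
                             (verts-cons⁻ S.A m₁) }
    where
    module S = Partition (partition P? M ap)
    head∉ : ∀ {v} → v ∈ verts G M → v ≡ a ⊎ v ≡ b → ⊥
    head∉ m (inj₁ refl) = proj₁ (disjoint⇒∉verts M ds) m
    head∉ m (inj₂ refl) = proj₂ (disjoint⇒∉verts M ds) m
  ... | no ¬Pe = record
    { A = S.A ; B = (a , b) ∷ S.B
    ; A⊆M = λ z → there (S.A⊆M z) ; B⊆M = λ { (here refl) → here refl ; (there z) → there (S.B⊆M z) }
    ; P-on-A = S.P-on-A ; ¬P-on-B = λ { (here refl) → ¬Pe ; (there z) → S.¬P-on-B z }
    ; M⊆A∪B = λ { (here refl) → inj₂ (here refl) ; (there z) → Data.Sum.map₂ there (S.M⊆A∪B z) }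
    ; length≡ = trans (cong suc S.length≡) (sym (+-suc (length S.A) (length S.B)))
    ; matchingA = S.matchingA ; matchingB = All.tabulate (λ z → All.lookup ds (S.B⊆M z)) ∷ S.matchingB
    ; disjoint = λ m₁ m₂ → [ head∉ (verts-mono S.A M S.A⊆M m₁) , (λ z → S.disjoint m₁ z) ]′
                             (verts-cons⁻ S.B m₂) }
    where
    module S = Partition (partition P? M ap)
    head∉ : ∀ {v} → v ∈ verts G M → v ≡ a ⊎ v ≡ b → ⊥
    head∉ m (inj₁ refl) = proj₁ (disjoint⇒∉verts M ds) m
    head∉ m (inj₂ refl) = proj₂ (disjoint⇒∉verts M ds) m

  partition-verts : ∀ {P : Edge G → Set} {M} (S : Partition P M) {v} → v ∈ verts G M →
    v ∈ verts G (Partition.A S) ⊎ v ∈ verts G (Partition.B S)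
  partition-verts {M = M} S m with verts⇒edge M m
  ... | e , e∈M , end = Data.Sum.map (λ z → end⇒verts (Partition.A S) z end)
                                     (λ z → end⇒verts (Partition.B S) z end) (Partition.M⊆A∪B S e∈M)

module Decomposition {n : ℕ} (G : Graph n) (T : BTree n) (D : NiceCliqueDecomposition G T) where

  covers : ∀ v → ∃[ p ] v ∈ bagAt T p
  covers = proj₁ (proj₁ D)

  edge-in-bag : ∀ u v → Adj G u v → ∃[ p ] (u ∈ bagAt T p × v ∈ bagAt T p)
  edge-in-bag = proj₁ (proj₂ (proj₁ D))

  bags-connected : ∀ v (p q : Pos T) → v ∈ bagAt T p → v ∈ bagAt T q →
    Walk (λ s → v ∈ bagAt T s) p q
  bags-connected = proj₂ (proj₂ (proj₁ D))

  bag-clique : ∀ p → Clique G (bagAt T p)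
  bag-clique = proj₁ (proj₂ D)

  root-empty : bag T ≡ ∅
  root-empty = proj₁ (proj₂ (proj₂ D))

  node-ok : ∀ p → NodeOK G (sub T p)
  node-ok = proj₂ (proj₂ (proj₂ D))

  child-clique : ∀ p {X t'} → sub T p ≡ node1 X t' → Clique G (bag t')
  child-clique p e = subst (Clique G) (cong bag sub-child) (bag-clique child)
    where open UnaryChild (unary-child p e)

  separator : ∀ {v c s q} → c ≼ s → v ∈ bagAt T s → v ∈ bagAt T q → ¬ c ≼ q → v ∈ bagAt T c
  separator {v} {s = s} {q} cs ms mq ¬cq = walk-leaves-through (bags-connected v s q ms mq) cs ¬cq

  parent-separator : ∀ {v p c q} → p ▷ c → OccursBelow T c v → v ∈ bagAt T q → ¬ c ≼ q →
    v ∈ bagAt T p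
  parent-separator {v} {q = q} pc (s , cs , ms) mq ¬cq =
    walk-leaves-via-parent (bags-connected v s q ms mq) cs ¬cq pc

  neighbour-below : ∀ {a b c} → Adj G a b → OccursBelow T c a → a ∉ bagAt T c → OccursBelow T c b
  neighbour-below {a} {b} {c} adj (s , cs , ms) a∉c with edge-in-bag a b adj
  ... | q , ma , mb with c ≼? q
  ...   | yes cq = q , cq , mb
  ...   | no ¬cq = ⊥-elim (a∉c (separator cs ms ma ¬cq))

  neighbour-below-parent : ∀ {a b p c} → p ▷ c → Adj G a b → OccursBelow T c a → a ∉ bagAt T p →
    OccursBelow T c b
  neighbour-below-parent {a} {b} {c = c} pc adj oa a∉p with edge-in-bag a b adj
  ... | q , ma , mb with c ≼? q
  ...   | yes cq = q , cq , mb
  ...   | no ¬cq = ⊥-elim (a∉p (parent-separator pc oa ma ¬cq))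

  NeighboursInBag : Subset n → Fin n → Pos T → Set
  NeighboursInBag B v s = ∀ w → w ∈ B → Adj G v w → w ∈ bagAt T s

  -- B has a vertex v outside the bag at p such that v and its B-neighbours lie
  -- in a common bag of the subtree at p (so v is simplicial in G[B]).
  SimplicialBelow : Pos T → Subset n → Set
  SimplicialBelow p B = ∃[ v ] (v ∈ B × v ∉ bagAt T p ×
    ∃[ s ] (p ≼ s × v ∈ bagAt T s × NeighboursInBag B v s))

  -- A vertex set occurring below p lies in the bag at p or has a simplicial
  -- vertex below p; this is the perfect elimination property of chordal graphs.
  Elimination : Pos T → Set
  Elimination p = ∀ B → (∀ {w} → w ∈ B → OccursBelow T p w) → B ⊆ bagAt T p ⊎ SimplicialBelow p B

  -- Passing from a child c to its parent p: if B has a vertex v₀ below c that is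
  -- not in the bag at p, apply the property at c to the part of B occurring in t'.
  elimination-step : ∀ {p c t'} → p ▷ c → sub T c ≡ t' → Elimination c →
    ∀ B {v₀} → v₀ ∈ B → v₀ ∉ bagAt T p → OccursBelow T c v₀ → SimplicialBelow p B
  elimination-step {p} {c} {t'} pc sub-c elim B {v₀} v₀∈B v₀∉p v₀-below
    with elim (B ∩ vertices t') (λ m → occurs⇒below c sub-c (vertices⇒occurs t' (proj₂ (∩⁻ m))))
  ... | inj₁ B'⊆c = v₀ , v₀∈B , v₀∉p , c , ▷⇒≼ pc , in-c v₀∈B v₀-below , neighbours
    where
    in-c : ∀ {w} → w ∈ B → OccursBelow T c w → w ∈ bagAt T c
    in-c w∈B o = B'⊆c (∩⁺ w∈B (occurs⇒vertices t' (below⇒occurs c sub-c o)))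
    neighbours : NeighboursInBag B v₀ c
    neighbours w w∈B adj = in-c w∈B (neighbour-below-parent pc adj v₀-below v₀∉p)
  ... | inj₂ (v , v∈B' , v∉c , s , cs , ms , nbrs) =
    v , v∈B , v∉p , s , ≼-trans (▷⇒≼ pc) cs , ms , neighbours
    where
    v∈B : v ∈ B
    v∈B = proj₁ (∩⁻ v∈B')
    v-below : OccursBelow T c v
    v-below = occurs⇒below c sub-c (vertices⇒occurs t' (proj₂ (∩⁻ v∈B')))
    v∉p : v ∉ bagAt T p
    v∉p v∈p = v∉c (separator (proj₁ (proj₂ v-below)) (proj₂ (proj₂ v-below)) v∈p (▷⇒⋡ pc))
    neighbours : NeighboursInBag B v s
    neighbours w w∈B adj =
      nbrs w (∩⁺ w∈B (occurs⇒vertices t' (below⇒occurs c sub-c (neighbour-below adj v-below v∉c)))) adj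

  elimination : ∀ (u : BTree n) (p : Pos T) → sub T p ≡ u → Elimination p
  elimination (node0 X) p e B below = inj₁ λ {w} m →
    let (s , ps , ms) = below m in subst (λ z → w ∈ bagAt T z) (leaf-subtree p e ps) ms
  elimination (node1 X t') p e B below with ⊆-or-witness B (bagAt T p)
  ... | inj₁ B⊆p = inj₁ B⊆p
  ... | inj₂ (v₀ , v₀∈B , v₀∉p) with below v₀∈B
  ...   | s , ps , ms with UnaryChild.cover (unary-child p e) ps
  ...     | inj₁ refl = ⊥-elim (v₀∉p ms)
  ...     | inj₂ cs = inj₂ (elimination-step C.edge C.sub-child (elimination t' C.child C.sub-child)
                              B v₀∈B v₀∉p (s , cs , ms))
    where module C = UnaryChild (unary-child p e)
  elimination (node2 X l r) p e B below with ⊆-or-witness B (bagAt T p)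
  ... | inj₁ B⊆p = inj₁ B⊆p
  ... | inj₂ (v₀ , v₀∈B , v₀∉p) with below v₀∈B
  ...   | s , ps , ms with BinaryChildren.cover (binary-children p e) ps
  ...     | inj₁ refl = ⊥-elim (v₀∉p ms)
  ...     | inj₂ (inj₁ cs) = inj₂ (elimination-step C.edgeL C.sub-L (elimination l C.cL C.sub-L)
                                     B v₀∈B v₀∉p (s , cs , ms))
    where module C = BinaryChildren (binary-children p e)
  ...     | inj₂ (inj₂ cs) = inj₂ (elimination-step C.edgeR C.sub-R (elimination r C.cR C.sub-R)
                                     B v₀∈B v₀∉p (s , cs , ms))
    where module C = BinaryChildren (binary-children p e)

  -- Every nonempty vertex set B has a vertex v which, together with all its
  -- neighbours in B, lies in one bag (applying the elimination property at the
  -- root, whose bag is empty).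
  simplicial-vertex : ∀ B {v₀} → v₀ ∈ B → ∃[ v ] (v ∈ B × ∃[ s ] (v ∈ bagAt T s × NeighboursInBag B v s))
  simplicial-vertex B v₀∈B with elimination T here refl B (λ {w} _ → let (q , m) = covers w in q , ≼-here , m)
  ... | inj₁ B⊆root = ⊥-elim (∉⊥ (≡∈ root-empty (B⊆root v₀∈B)))
  ... | inj₂ (v , v∈B , _ , s , _ , ms , nbrs) = v , v∈B , s , ms , nbrs

  -- Graphs with a clique tree decomposition are chordal, so r-degeneracy of
  -- G[A] follows once every clique of G[A] has at most r + 1 vertices: a
  -- simplicial vertex of a subgraph has all its neighbours in one clique.
  small-cliques⇒degenerate : ∀ {r A} →
    (∀ {K v} → Clique G K → K ⊆ A → v ∈ K → ∣ K ─ ⁅ v ⁆ ∣ ≤ r) → Degenerate G r A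
  small-cliques⇒degenerate small B F (B⊆A , _ , F-edges) (v₀ , v₀∈B) with simplicial-vertex B v₀∈B
  ... | v , v∈B , s , v∈s , nbrs = v , v∈B , ≤-trans (p⊆q⇒∣p∣≤∣q∣ nbr⊆K-v) (small K-clique K⊆A (∩⁺ v∈B v∈s))
    where
    K-clique : Clique G (B ∩ bagAt T s)
    K-clique = clique-mono G (λ m → proj₂ (∩⁻ m)) (bag-clique s)
    K⊆A : B ∩ bagAt T s ⊆ _
    K⊆A m = B⊆A (proj₁ (∩⁻ m))
    nbr⊆K-v : nbr G F v ⊆ (B ∩ bagAt T s) ─ ⁅ v ⁆
    nbr⊆K-v {w} m with F-edges v w (nbr⁻ G F v w m)
    ... | _ , w∈B , adj = ─⁺ (∩⁺ w∈B (nbrs w w∈B adj)) (∉⁅⁆ λ e → adj-≢ G adj (sym e))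

-- (a) At a leaf with empty bag R_t = {(∅, ∅, 0)}: G_t has no vertex, hence no edge.
leaf-R : ∀ {n} r (G : Graph n) {X} → X ≡ ∅ →
  ∀ S N k → InR G r (node0 X) S N k ⇔ (S ≡ ∅ × N ≡ ∅ × k ≡ 0)
leaf-R r G refl S N k = mk⇔ forward backward
  where
  ⊆∅ : ∀ {Y} → Y ⊆ ∅ → Y ≡ ∅
  ⊆∅ Y⊆∅ = ext Y⊆∅ (λ m → ⊥-elim (∉⊥ m))
  no-edges : ∀ M → All (GoodEdge G (node0 ∅)) M → length M ≡ 0
  no-edges []      _                               = refl
  no-edges (_ ∷ _) ((_ , (here , a∈∅) , _) ∷ _) = ⊥-elim (∉⊥ a∈∅)
  forward : InR G r (node0 ∅) S N k → S ≡ ∅ × N ≡ ∅ × k ≡ 0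
  forward (N⊆S , S⊆∅ , M , (_ , good) , k≡ , _ , _) =
    ⊆∅ S⊆∅ , ⊆∅ (λ m → S⊆∅ (N⊆S m)) , trans k≡ (no-edges M good)
  backward : S ≡ ∅ × N ≡ ∅ × k ≡ 0 → InR G r (node0 ∅) S N k
  backward (refl , refl , refl) =
    (λ m → m) , (λ m → m) , [] , ([] , []) , refl , sym (∩-zeroˡ ∅) ,
    λ B F (B⊆∅ , _) (v , v∈B) → ⊥-elim ([ ∉⊥ , ∉⊥ ]′ (∪⁻ (B⊆∅ v∈B)))

module Introduce {n : ℕ} (r : ℕ) (G : Graph n) (T : BTree n) (D : NiceCliqueDecomposition G T)
                 (p : Pos T) (X : Subset n) (t' : BTree n) (x : Fin n)
                 (e : sub T p ≡ node1 X t') (t'⊆X : bag t' ⊆ X) (X─t'≡x : X ─ bag t' ≡ ⁅ x ⁆) where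
  open Decomposition G T D
  open UnaryChild (unary-child p e)

  x∈X─t' : x ∈ X ─ bag t'
  x∈X─t' = ≡∈ (sym X─t'≡x) (x∈⁅x⁆ x)

  x∈X : x ∈ X
  x∈X = proj₁ (─⁻ x∈X─t')

  x∉t' : x ∉ bag t'
  x∉t' = proj₂ (─⁻ x∈X─t')

  old : ∀ {v} → v ∈ X → v ≢ x → v ∈ bag t'
  old {v} v∈X v≢x with v ∈? bag t'
  ... | yes v∈t' = v∈t'
  ... | no v∉t'  = ⊥-elim (v≢x (⁅⁆⁻ (≡∈ X─t'≡x (─⁺ v∈X v∉t'))))

  -- x does not occur in G_t': otherwise it would lie in the bag separating
  -- the subtree of the child from p
  x-fresh : ¬ Occurs t' x
  x-fresh o with occurs⇒below child sub-child o
  ... | s , cs , ms =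
    x∉t' (≡∈ (cong bag sub-child) (separator cs ms (≡∈ (sym (cong bag e)) x∈X) (▷⇒⋡ edge)))

  ≢x : ∀ {v} → Occurs t' v → v ≢ x
  ≢x o refl = x-fresh o

  occurs-down : ∀ {v} → Occurs (node1 X t') v → v ≢ x → Occurs t' v
  occurs-down o v≢x = [ (λ v∈X → occurs-bag (old v∈X v≢x)) , (λ o' → o') ]′ (occurs-node1 o)

  -- x has no neighbour in G_t' outside X_t', since that neighbour would
  -- force x to occur below the child
  no-deep-neighbour : ∀ {w} → Adj G x w → Occurs t' w → w ∉ bag t' → ⊥
  no-deep-neighbour adj o w∉t' =
    x-fresh (below⇒occurs child sub-child
      (neighbour-below (adj-sym G adj) (occurs⇒below child sub-child o)
                       (λ m → w∉t' (≡∈ (cong bag sub-child) m))))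

  neighbour-of-x : ∀ {w} → Adj G x w → Occurs (node1 X t') w → w ∈ X
  neighbour-of-x {w} adj o with w ∈? X
  ... | yes w∈X = w∈X
  ... | no w∉X  = ⊥-elim (no-deep-neighbour adj (occurs-down o (λ { refl → w∉X x∈X }))
                                                 (λ m → w∉X (t'⊆X m)))

  good-down : ∀ {ed} → GoodEdge G (node1 X t') ed → GoodEdge G t' ed
  good-down {a , b} (adj , oa , ob , ¬both) =
    adj , occurs-down oa a≢x , occurs-down ob b≢x , λ (a∈ , b∈) → ¬both (t'⊆X a∈ , t'⊆X b∈)
    where
    a≢x : a ≢ x
    a≢x refl = ¬both (x∈X , neighbour-of-x adj ob)
    b≢x : b ≢ x
    b≢x refl = ¬both (neighbour-of-x (adj-sym G adj) oa , x∈X)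

  good-up : ∀ {ed} → GoodEdge G t' ed → GoodEdge G (node1 X t') ed
  good-up {a , b} (adj , oa , ob , ¬both) =
    adj , occurs-in1 oa , occurs-in1 ob , λ (a∈ , b∈) → ¬both (old a∈ (≢x oa) , old b∈ (≢x ob))

  same-trace : ∀ M → All (GoodEdge G t') M → verts G M ∩ X ≡ verts G M ∩ bag t'
  same-trace M good = ext (λ m → let (u , w) = ∩⁻ m in ∩⁺ u (old w (≢x (matched-occur M good u))))
                          (λ m → let (u , w) = ∩⁻ m in ∩⁺ u (t'⊆X w))

  matching-down : ∀ {M} → IsMatchingIn G (node1 X t') M → IsMatchingIn G t' M
  matching-down (matching , good) = matching , All.map good-down good

  matching-up : ∀ {M} → IsMatchingIn G t' M → IsMatchingIn G (node1 X t') M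
  matching-up (matching , good) = matching , All.map good-up good

  x-unmatched : ∀ M → All (GoodEdge G t') M → x ∉ verts G M
  x-unmatched M good m = x-fresh (matched-occur M good m)

  forward-old : ∀ {S N k} → x ∉ S → InR G r (node1 X t') S N k → InR G r t' S N k
  forward-old x∉S (N⊆S , S⊆X , M , matching , k≡ , N≡ , deg) =
    N⊆S , (λ m → old (S⊆X m) (λ { refl → x∉S m })) , M , matching-down matching , k≡ ,
    trans N≡ (same-trace M (proj₂ (matching-down matching))) , deg

  -- if x ∈ S then S - x gives a triple of R_t'; S is a clique in an r-degenerate
  -- graph, so |S - x| ≤ r
  forward-new : ∀ {S N k} → x ∈ S → InR G r (node1 X t') S N k →
    InR G r t' (S ─ ⁅ x ⁆) N k × ∣ S ─ ⁅ x ⁆ ∣ ≤ r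
  forward-new {S} x∈S (N⊆S , S⊆X , M , matching , k≡ , N≡ , deg) =
    (N⊆S' , S'⊆t' , M , matching-down matching , k≡ , trans N≡ (same-trace M good) ,
     degenerate-mono G (λ m → [ ∪ˡ , (λ z → ∪ʳ (proj₁ (─⁻ z))) ]′ (∪⁻ m)) deg) ,
    clique-bound G (clique-mono G (λ m → ≡∈ (sym (cong bag e)) (S⊆X m)) (bag-clique p)) ∪ʳ deg x∈S
    where
    good : All (GoodEdge G t') M
    good = proj₂ (matching-down matching)
    N⊆S' : _ ⊆ S ─ ⁅ x ⁆
    N⊆S' m = ─⁺ (N⊆S m) (∉⁅⁆ λ { refl → x-unmatched M good (proj₁ (∩⁻ (≡∈ N≡ m))) })
    S'⊆t' : S ─ ⁅ x ⁆ ⊆ bag t'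
    S'⊆t' m = let (u , w) = ─⁻ m in old (S⊆X u) (λ { refl → w (x∈⁅x⁆ x) })

  backward-old : ∀ {S N k} → InR G r t' S N k → InR G r (node1 X t') S N k
  backward-old (N⊆S , S⊆t' , M , matching , k≡ , N≡ , deg) =
    N⊆S , (λ m → t'⊆X (S⊆t' m)) , M , matching-up matching , k≡ ,
    trans N≡ (sym (same-trace M (proj₂ matching))) , deg

  -- adding x to S: the neighbours of x in V(M) ∪ S' lie in S', so x has degree
  -- at most |S'| ≤ r and r-degeneracy is preserved
  backward-new : ∀ {S' N k} → InR G r t' S' N k → ∣ S' ∣ ≤ r → InR G r (node1 X t') (S' ∪ ⁅ x ⁆) N k
  backward-new {S'} (N⊆S' , S'⊆t' , M , matching , k≡ , N≡ , deg) ∣S'∣≤r =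
    (λ m → ∪ˡ (N⊆S' m)) , S⊆X , M , matching-up matching , k≡ ,
    trans N≡ (sym (same-trace M (proj₂ matching))) ,
    subst (Degenerate G r) (∪-assoc (verts G M) S' ⁅ x ⁆) (add-low-degree G x deg ∣S'∣≤r nbrs⊆S')
    where
    S⊆X : S' ∪ ⁅ x ⁆ ⊆ X
    S⊆X m = [ (λ z → t'⊆X (S'⊆t' z)) , (λ z → subst (_∈ X) (sym (⁅⁆⁻ z)) x∈X) ]′ (∪⁻ m)
    nbrs⊆S' : ∀ w → w ∈ verts G M ∪ S' → Adj G x w → w ∈ S'
    nbrs⊆S' w m adj with ∪⁻ m
    ... | inj₂ w∈S' = w∈S'
    ... | inj₁ w∈M with w ∈? bag t'
    ...   | yes w∈t' = N⊆S' (≡∈ (sym N≡) (∩⁺ w∈M w∈t'))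
    ...   | no w∉t'  = ⊥-elim (no-deep-neighbour adj (matched-occur M (proj₂ matching) w∈M) w∉t')

  introduce-R : ∀ S N k → InR G r (node1 X t') S N k ⇔
    (InR G r t' S N k ⊎ ∃[ S' ] (InR G r t' S' N k × ∣ S' ∣ ≤ r × S ≡ S' ∪ ⁅ x ⁆))
  introduce-R S N k = mk⇔ forward backward
    where
    forward : InR G r (node1 X t') S N k →
      InR G r t' S N k ⊎ ∃[ S' ] (InR G r t' S' N k × ∣ S' ∣ ≤ r × S ≡ S' ∪ ⁅ x ⁆)
    forward R with x ∈? S
    ... | no x∉S  = inj₁ (forward-old x∉S R)
    ... | yes x∈S = let (R' , size) = forward-new x∈S R in
                    inj₂ (S ─ ⁅ x ⁆ , R' , size , sym (─⁅⁆∪⁅⁆ x∈S))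
    backward : InR G r t' S N k ⊎ ∃[ S' ] (InR G r t' S' N k × ∣ S' ∣ ≤ r × S ≡ S' ∪ ⁅ x ⁆) →
      InR G r (node1 X t') S N k
    backward (inj₁ R')                        = backward-old R'
    backward (inj₂ (S' , R' , size , refl)) = backward-new R' size

module _ {n : ℕ} (G : Graph n) where

  Witness : ℕ → BTree n → Subset n → Subset n → ℕ → List (Edge G) → Set
  Witness r t S N k M = N ⊆ S × S ⊆ bag t × IsMatchingIn G t M × k ≡ length M ×
                        N ≡ verts G M ∩ bag t × Degenerate G r (verts G M ∪ S)

  witnessed : ∀ {r t S N k} M → Witness r t S N k M → InR G r t S N k
  witnessed M (N⊆S , S⊆t , matching , k≡ , N≡ , deg) = N⊆S , S⊆t , M , matching , k≡ , N≡ , deg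

-- (c) A forget node with subtree node1 X t' and X = X_t' - {x}.
module Forget {n : ℕ} (r : ℕ) (G : Graph n) (X : Subset n) (t' : BTree n) (x : Fin n)
              (t'-clique : Clique G (bag t')) (X⊆t' : X ⊆ bag t') (t'─X≡x : bag t' ─ X ≡ ⁅ x ⁆) where

  x∈t'─X : x ∈ bag t' ─ X
  x∈t'─X = ≡∈ (sym t'─X≡x) (x∈⁅x⁆ x)

  x∈t' : x ∈ bag t'
  x∈t' = proj₁ (─⁻ x∈t'─X)

  x∉X : x ∉ X
  x∉X = proj₂ (─⁻ x∈t'─X)

  kept : ∀ {v} → v ∈ bag t' → v ≢ x → v ∈ X
  kept {v} v∈t' v≢x with v ∈? X
  ... | yes v∈X = v∈X
  ... | no v∉X  = ⊥-elim (v≢x (⁅⁆⁻ (≡∈ t'─X≡x (─⁺ v∈t' v∉X))))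

  occurs-down : ∀ {v} → Occurs (node1 X t') v → Occurs t' v
  occurs-down o = [ (λ v∈X → occurs-bag (X⊆t' v∈X)) , (λ o' → o') ]′ (occurs-node1 o)

  good-up : ∀ {ed} → GoodEdge G t' ed → GoodEdge G (node1 X t') ed
  good-up (adj , oa , ob , ¬both) = adj , occurs-in1 oa , occurs-in1 ob , λ (a∈ , b∈) → ¬both (X⊆t' a∈ , X⊆t' b∈)

  good-down : ∀ {a b} → GoodEdge G (node1 X t') (a , b) → ¬ (a ∈ bag t' × b ∈ bag t') →
    GoodEdge G t' (a , b)
  good-down (adj , oa , ob , _) ¬both = adj , occurs-down oa , occurs-down ob , ¬both

  avoids-x : ∀ {a b} → a ≢ x → b ≢ x → ¬ (a ∈ X × b ∈ X) → ¬ (a ∈ bag t' × b ∈ bag t')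
  avoids-x a≢x b≢x ¬both (a∈ , b∈) = ¬both (kept a∈ a≢x , kept b∈ b≢x)

  good-avoiding : ∀ {M} → All (GoodEdge G (node1 X t')) M → x ∉ verts G M → All (GoodEdge G t') M
  good-avoiding {M} good x∉M = All.tabulate λ {ed} e∈M →
    let (a∈M , b∈M) = edge⇒verts M e∈M ; g = All.lookup good e∈M in
    good-down g (avoids-x (λ { refl → x∉M a∈M }) (λ { refl → x∉M b∈M }) (proj₂ (proj₂ (proj₂ g))))

  trace-avoiding : ∀ M → x ∉ verts G M → verts G M ∩ X ≡ verts G M ∩ bag t'
  trace-avoiding M x∉M = ext (λ m → let (u , w) = ∩⁻ m in ∩⁺ u (X⊆t' w))
                             (λ m → let (u , w) = ∩⁻ m in ∩⁺ u (kept w (λ { refl → x∉M u })))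

  absorb-x : ∀ {S} M → x ∈ verts G M → verts G M ∪ (S ∪ ⁅ x ⁆) ⊆ verts G M ∪ S
  absorb-x M x∈M m =
    [ ∪ˡ , (λ u → [ ∪ʳ , (λ z → ∪ˡ (subst (_∈ verts G M) (sym (⁅⁆⁻ z)) x∈M)) ]′ (∪⁻ u)) ]′ (∪⁻ m)

  S⊆X⇒x∉S : ∀ {S} → S ⊆ X → x ∉ S
  S⊆X⇒x∉S S⊆X m = x∉X (S⊆X m)

  ─x⊆X : ∀ {S'} → S' ⊆ bag t' → S' ─ ⁅ x ⁆ ⊆ X
  ─x⊆X S'⊆t' m = let (u , w) = ─⁻ m in kept (S'⊆t' u) (λ { refl → w (x∈⁅x⁆ x) })

  ∪x⊆t' : ∀ {S} → S ⊆ X → S ∪ ⁅ x ⁆ ⊆ bag t'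
  ∪x⊆t' S⊆X m = [ (λ z → X⊆t' (S⊆X z)) , (λ z → subst (_∈ bag t') (sym (⁅⁆⁻ z)) x∈t') ]′ (∪⁻ m)

  -- The three ways in which a triple of R_t arises from a triple of R_t':
  -- x is unmatched and not in S; x is matched now, to a vertex y of S'; or
  -- x was matched before.
  Unmatched : Subset n → Subset n → ℕ → Set
  Unmatched S N k = InR G r t' S N k × x ∉ S

  MatchedNow : Subset n → Subset n → ℕ → Set
  MatchedNow S N k = ∃[ S' ] ∃[ N' ] ∃[ k' ] ∃[ y ]
    (InR G r t' S' N' k' × x ∈ S' × x ∉ N' × y ∈ S' × y ∉ N' × y ≢ x ×
     S ≡ S' ─ ⁅ x ⁆ × N ≡ N' ∪ ⁅ y ⁆ × k ≡ suc k')

  MatchedBefore : Subset n → Subset n → ℕ → Set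
  MatchedBefore S N k = ∃[ S' ] ∃[ N' ] ∃[ k' ]
    (InR G r t' S' N' k' × x ∈ N' × S ≡ S' ─ ⁅ x ⁆ × N ≡ N' ─ ⁅ x ⁆ × k ≡ k')

  forward-unmatched : ∀ {S N k M} → Witness G r (node1 X t') S N k M → x ∉ verts G M →
    Unmatched S N k
  forward-unmatched {M = M} (N⊆S , S⊆X , (matching , good) , k≡ , N≡ , deg) x∉M =
    witnessed G M (N⊆S , (λ m → X⊆t' (S⊆X m)) , (matching , good-avoiding good x∉M) , k≡ ,
                   trans N≡ (trace-avoiding M x∉M) , deg) ,
    S⊆X⇒x∉S S⊆X

  partner-≢ : ∀ {M} → All (GoodEdge G (node1 X t')) M → (W : WithoutEdgeAt {G = G} x M) →
    WithoutEdgeAt.y W ≢ x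
  partner-≢ good W refl =
    [ (λ e → adj-≢ G (proj₁ (All.lookup good e)) refl) , (λ e → adj-≢ G (proj₁ (All.lookup good e)) refl) ]′
      (WithoutEdgeAt.edge∈M W)

  -- x is matched to y ∈ X: the edge xy of M is removed, and counted at this node
  forward-matched-now : ∀ {S N k M} → Witness G r (node1 X t') S N k M → (W : WithoutEdgeAt {G = G} x M) →
    WithoutEdgeAt.y W ∈ X → MatchedNow S N k
  forward-matched-now {S} {N} {k} {M} (N⊆S , S⊆X , (_ , good) , k≡ , N≡ , deg) W y∈X =
    S ∪ ⁅ x ⁆ , verts G M' ∩ bag t' , length M' , y ,
    witnessed G M' (N'⊆S' , ∪x⊆t' S⊆X , (matching , good-avoiding good' x∉M') , refl , refl ,
                    degenerate-mono G V'⊆V deg) ,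
    ∪ʳ (x∈⁅x⁆ x) , (λ m → x∉M' (proj₁ (∩⁻ m))) , ∪ˡ (N⊆S y∈N) , (λ m → y∉M' (proj₁ (∩⁻ m))) ,
    (λ { refl → x∉X y∈X }) , sym (∪⁅⁆─⁅⁆ (S⊆X⇒x∉S S⊆X)) , trans N≡ trace , trans k≡ length≡
    where
    open WithoutEdgeAt W
    good' : All (GoodEdge G (node1 X t')) M'
    good' = All.tabulate (λ z → All.lookup good (M'⊆M z))
    y∈N : y ∈ N
    y∈N = ≡∈ (sym N≡) (∩⁺ (partner-matched W) y∈X)
    in-N : ∀ {v} → v ∈ verts G M' → v ∈ bag t' → v ∈ N
    in-N u w = ≡∈ (sym N≡) (∩⁺ (rest-matched W u) (kept w λ { refl → x∉M' u }))
    N'⊆S' : verts G M' ∩ bag t' ⊆ S ∪ ⁅ x ⁆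
    N'⊆S' m = let (u , w) = ∩⁻ m in ∪ˡ (N⊆S (in-N u w))
    V'⊆V : verts G M' ∪ (S ∪ ⁅ x ⁆) ⊆ verts G M ∪ S
    V'⊆V m = [ (λ u → ∪ˡ (rest-matched W u)) , (λ u → absorb-x M (x-matched W) (∪ʳ u)) ]′ (∪⁻ m)
    trace : verts G M ∩ X ≡ (verts G M' ∩ bag t') ∪ ⁅ y ⁆
    trace = ext forth back
      where
      forth : ∀ {v} → v ∈ verts G M ∩ X → v ∈ (verts G M' ∩ bag t') ∪ ⁅ y ⁆
      forth m with ∩⁻ m
      ... | u , w with verts-without W u
      ...   | inj₁ (inj₁ refl) = ⊥-elim (x∉X w)
      ...   | inj₁ (inj₂ refl) = ∪ʳ (x∈⁅x⁆ y)
      ...   | inj₂ u'          = ∪ˡ (∩⁺ u' (X⊆t' w))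
      back : ∀ {v} → v ∈ (verts G M' ∩ bag t') ∪ ⁅ y ⁆ → v ∈ verts G M ∩ X
      back m = [ (λ z → let (u , w) = ∩⁻ z in ∩⁺ (rest-matched W u) (kept w λ { refl → x∉M' u }))
               , (λ z → subst (_∈ verts G M ∩ X) (sym (⁅⁆⁻ z)) (∩⁺ (partner-matched W) y∈X)) ]′ (∪⁻ m)

  -- x is matched to y ∉ X: then y ∉ X_t' and M stays a matching of G_t'
  forward-matched-before : ∀ {S N k M} → Witness G r (node1 X t') S N k M → (W : WithoutEdgeAt {G = G} x M) →
    WithoutEdgeAt.y W ∉ X → MatchedBefore S N k
  forward-matched-before {S} {N} {k} {M} (N⊆S , S⊆X , (matching , good) , k≡ , N≡ , deg) W y∉X =
    S ∪ ⁅ x ⁆ , verts G M ∩ bag t' , k ,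
    witnessed G M (N'⊆S' , ∪x⊆t' S⊆X , (matching , All.tabulate good') , k≡ , refl ,
                   degenerate-mono G (absorb-x M (x-matched W)) deg) ,
    ∩⁺ (x-matched W) x∈t' , sym (∪⁅⁆─⁅⁆ (S⊆X⇒x∉S S⊆X)) , trans N≡ trace , refl
    where
    open WithoutEdgeAt W using (y; M⊆; M'⊆M; x∉M')
    y∉t' : y ∉ bag t'
    y∉t' m = y∉X (kept m (partner-≢ good W))
    good' : ∀ {ed} → ed ∈ₗ M → GoodEdge G t' ed
    good' e∈M with M⊆ e∈M
    ... | inj₁ refl        = good-down (All.lookup good e∈M) (λ (_ , y∈) → y∉t' y∈)
    ... | inj₂ (inj₁ refl) = good-down (All.lookup good e∈M) (λ (y∈ , _) → y∉t' y∈)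
    ... | inj₂ (inj₂ e∈M') = All.lookup (good-avoiding (All.tabulate λ z → All.lookup good (M'⊆M z)) x∉M') e∈M'
    N'⊆S' : verts G M ∩ bag t' ⊆ S ∪ ⁅ x ⁆
    N'⊆S' {v} m with v ≟ x
    ... | yes refl = ∪ʳ (x∈⁅x⁆ x)
    ... | no v≢x   = let (u , w) = ∩⁻ m in ∪ˡ (N⊆S (≡∈ (sym N≡) (∩⁺ u (kept w v≢x))))
    trace : verts G M ∩ X ≡ (verts G M ∩ bag t') ─ ⁅ x ⁆
    trace = ext (λ m → let (u , w) = ∩⁻ m in ─⁺ (∩⁺ u (X⊆t' w)) (∉⁅⁆ λ { refl → x∉X w }))
                (λ m → let (u , w) = ─⁻ m ; (u₁ , u₂) = ∩⁻ u in ∩⁺ u₁ (kept u₂ λ { refl → w (x∈⁅x⁆ x) }))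

  forward-witness : ∀ {S N k M} → Witness G r (node1 X t') S N k M →
    Unmatched S N k ⊎ MatchedNow S N k ⊎ MatchedBefore S N k
  forward-witness {M = M} w@(_ , _ , (matching , _) , _) with x ∈? verts G M
  ... | no x∉M  = inj₁ (forward-unmatched w x∉M)
  ... | yes x∈M with without-edge-at M matching x∈M
  ...   | W with WithoutEdgeAt.y W ∈? X
  ...     | yes y∈X = inj₂ (inj₁ (forward-matched-now w W y∈X))
  ...     | no y∉X  = inj₂ (inj₂ (forward-matched-before w W y∉X))

  backward-unmatched : ∀ {S N k} → Unmatched S N k → InR G r (node1 X t') S N k
  backward-unmatched ((N⊆S , S⊆t' , M , (matching , good) , k≡ , N≡ , deg) , x∉S) =
    witnessed G M (N⊆S , S⊆X , (matching , All.map good-up good) , k≡ ,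
                   trans N≡ (sym (trace-avoiding M x∉M)) , deg)
    where
    x∉M : x ∉ verts G M
    x∉M m = x∉S (N⊆S (≡∈ (sym N≡) (∩⁺ m x∈t')))
    S⊆X : _ ⊆ X
    S⊆X m = kept (S⊆t' m) (λ { refl → x∉S m })

  -- x and y are unmatched in M', so the edge xy (an edge since X_t' is a clique)
  -- extends M' to a matching of G_t
  backward-matched-now : ∀ {S N k} → MatchedNow S N k → InR G r (node1 X t') S N k
  backward-matched-now (S' , N' , k' , y , (N'⊆S' , S'⊆t' , M' , (matching , good) , k≡ , N'≡ , deg) ,
                        x∈S' , x∉N' , y∈S' , y∉N' , y≢x , refl , refl , refl) =
    witnessed G ((x , y) ∷ M')
      (N⊆S , ─x⊆X S'⊆t' ,
       (∉verts⇒disjoint M' x∉M' y∉M' ∷ matching , xy-good ∷ All.map good-up good) ,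
       cong suc k≡ , trace , degenerate-mono G V⊆V' deg)
    where
    unmatched : ∀ {v} → v ∈ S' → v ∉ N' → v ∉ verts G M'
    unmatched v∈S' v∉N' m = v∉N' (≡∈ (sym N'≡) (∩⁺ m (S'⊆t' v∈S')))
    x∉M' = unmatched x∈S' x∉N'
    y∉M' = unmatched y∈S' y∉N'
    xy-good : GoodEdge G (node1 X t') (x , y)
    xy-good = t'-clique x y (S'⊆t' x∈S') (S'⊆t' y∈S') (λ e → y≢x (sym e)) ,
              occurs-in1 (occurs-bag (S'⊆t' x∈S')) , occurs-in1 (occurs-bag (S'⊆t' y∈S')) ,
              λ (x∈X , _) → x∉X x∈X
    N⊆S : N' ∪ ⁅ y ⁆ ⊆ S' ─ ⁅ x ⁆
    N⊆S m = [ (λ z → ─⁺ (N'⊆S' z) (∉⁅⁆ λ { refl → x∉N' z }))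
            , (λ z → subst (_∈ S' ─ ⁅ x ⁆) (sym (⁅⁆⁻ z)) (─⁺ y∈S' (∉⁅⁆ y≢x))) ]′ (∪⁻ m)
    trace : N' ∪ ⁅ y ⁆ ≡ verts G ((x , y) ∷ M') ∩ X
    trace = ext forth back
      where
      forth : ∀ {v} → v ∈ N' ∪ ⁅ y ⁆ → v ∈ verts G ((x , y) ∷ M') ∩ X
      forth m = [ (λ z → let (u , w) = ∩⁻ (≡∈ N'≡ z) in ∩⁺ (verts-tail M' u) (kept w λ { refl → x∉N' z }))
                , (λ z → subst (_∈ verts G ((x , y) ∷ M') ∩ X) (sym (⁅⁆⁻ z))
                                (∩⁺ (verts-snd M') (kept (S'⊆t' y∈S') y≢x))) ]′ (∪⁻ m)
      back : ∀ {v} → v ∈ verts G ((x , y) ∷ M') ∩ X → v ∈ N' ∪ ⁅ y ⁆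
      back m with ∩⁻ m
      ... | u , w with verts-cons⁻ M' u
      ...   | inj₁ (inj₁ refl) = ⊥-elim (x∉X w)
      ...   | inj₁ (inj₂ refl) = ∪ʳ (x∈⁅x⁆ y)
      ...   | inj₂ u'          = ∪ˡ (≡∈ (sym N'≡) (∩⁺ u' (X⊆t' w)))
    V⊆V' : verts G ((x , y) ∷ M') ∪ (S' ─ ⁅ x ⁆) ⊆ verts G M' ∪ S'
    V⊆V' m with ∪⁻ m
    ... | inj₂ u = ∪ʳ (proj₁ (─⁻ u))
    ... | inj₁ u with verts-cons⁻ M' u
    ...   | inj₁ (inj₁ refl) = ∪ʳ x∈S'
    ...   | inj₁ (inj₂ refl) = ∪ʳ y∈S'
    ...   | inj₂ u'          = ∪ˡ u'

  backward-matched-before : ∀ {S N k} → MatchedBefore S N k → InR G r (node1 X t') S N k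
  backward-matched-before (S' , N' , k' , (N'⊆S' , S'⊆t' , M , (matching , good) , k≡ , N'≡ , deg) ,
                           x∈N' , refl , refl , refl) =
    witnessed G M (N⊆S , ─x⊆X S'⊆t' , (matching , All.map good-up good) , k≡ , trace ,
                   degenerate-mono G (λ m → [ ∪ˡ , (λ u → ∪ʳ (proj₁ (─⁻ u))) ]′ (∪⁻ m)) deg)
    where
    N⊆S : N' ─ ⁅ x ⁆ ⊆ S' ─ ⁅ x ⁆
    N⊆S m = let (u , w) = ─⁻ m in ─⁺ (N'⊆S' u) w
    trace : N' ─ ⁅ x ⁆ ≡ verts G M ∩ X
    trace = ext (λ m → let (u , w) = ─⁻ m ; (u₁ , u₂) = ∩⁻ (≡∈ N'≡ u) in
                       ∩⁺ u₁ (kept u₂ λ { refl → w (x∈⁅x⁆ x) }))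
                (λ m → let (u , w) = ∩⁻ m in ─⁺ (≡∈ (sym N'≡) (∩⁺ u (X⊆t' w))) (∉⁅⁆ λ { refl → x∉X w }))

  forget-R : ∀ S N k → InR G r (node1 X t') S N k ⇔
    (Unmatched S N k ⊎ MatchedNow S N k ⊎ MatchedBefore S N k)
  forget-R S N k =
    mk⇔ (λ (N⊆S , S⊆X , M , rest) → forward-witness (N⊆S , S⊆X , rest))
        [ backward-unmatched , [ backward-matched-now , backward-matched-before ]′ ]′

module Join {n : ℕ} (r : ℕ) (G : Graph n) (T : BTree n) (D : NiceCliqueDecomposition G T)
            (p : Pos T) (X : Subset n) (t' t'' : BTree n) (e : sub T p ≡ node2 X t' t'') where
  open Decomposition G T D
  open BinaryChildren (binary-children p e)

  same-bags : X ≡ bag t' × X ≡ bag t''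
  same-bags = subst (NodeOK G) e (node-ok p)

  X→t' : ∀ {v} → v ∈ X → v ∈ bag t'
  X→t' = ≡∈ (proj₁ same-bags)

  t'→X : ∀ {v} → v ∈ bag t' → v ∈ X
  t'→X = ≡∈ (sym (proj₁ same-bags))

  X→t'' : ∀ {v} → v ∈ X → v ∈ bag t''
  X→t'' = ≡∈ (proj₂ same-bags)

  t''→X : ∀ {v} → v ∈ bag t'' → v ∈ X
  t''→X = ≡∈ (sym (proj₂ same-bags))

  shared-in-X : ∀ {v} → Occurs t' v → Occurs t'' v → v ∈ X
  shared-in-X o' o'' with occurs⇒below cR sub-R o''
  ... | s , cRs , ms = ≡∈ (cong bag e) (parent-separator edgeL (occurs⇒below cL sub-L o') ms
                                                          (λ cLs → disjoint cLs cRs))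

  neighbour-in-t'' : ∀ {a b} → Adj G a b → Occurs t'' a → a ∉ X → Occurs t'' b
  neighbour-in-t'' adj o a∉X =
    below⇒occurs cR sub-R (neighbour-below-parent edgeR adj (occurs⇒below cR sub-R o)
                                                    (λ m → a∉X (≡∈ (cong bag e) m)))

  good-left : ∀ {ed} → GoodEdge G t' ed → GoodEdge G (node2 X t' t'') ed
  good-left (adj , oa , ob , ¬both) = adj , occurs-inL oa , occurs-inL ob , λ (a∈ , b∈) → ¬both (X→t' a∈ , X→t' b∈)

  good-right : ∀ {ed} → GoodEdge G t'' ed → GoodEdge G (node2 X t' t'') ed
  good-right (adj , oa , ob , ¬both) = adj , occurs-inR oa , occurs-inR ob , λ (a∈ , b∈) → ¬both (X→t'' a∈ , X→t'' b∈)

  -- an edge of G_t lies in G_t' or, failing that, in G_t''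
  InLeft : Edge G → Set
  InLeft (a , b) = Occurs t' a × Occurs t' b

  in-left? : ∀ ed → Dec (InLeft ed)
  in-left? (a , b) with occurs? t' a | occurs? t' b
  ... | yes oa | yes ob = yes (oa , ob)
  ... | no ¬oa | _      = no λ (oa , _) → ¬oa oa
  ... | yes _  | no ¬ob = no λ (_ , ob) → ¬ob ob

  good-down-left : ∀ {ed} → GoodEdge G (node2 X t' t'') ed → InLeft ed → GoodEdge G t' ed
  good-down-left (adj , _ , _ , ¬both) (oa , ob) = adj , oa , ob , λ (a∈ , b∈) → ¬both (t'→X a∈ , t'→X b∈)

  only-right : ∀ {v} → Occurs (node2 X t' t'') v → ¬ Occurs t' v → Occurs t'' v × v ∉ X
  only-right o ¬o' = [ (λ v∈X → ⊥-elim (¬o' (occurs-bag (X→t' v∈X))))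
                     , [ (λ o' → ⊥-elim (¬o' o')) , (λ o'' → o'' , λ v∈X → ¬o' (occurs-bag (X→t' v∈X))) ]′ ]′
                     (occurs-node2 o)

  -- an end outside G_t' lies in G_t'' - X, and then so does its neighbour
  good-down-right : ∀ {a b} → GoodEdge G (node2 X t' t'') (a , b) → ¬ InLeft (a , b) → GoodEdge G t'' (a , b)
  good-down-right {a} {b} (adj , oa , ob , ¬both) ¬left with occurs? t' a
  ... | no ¬oa = let (oa'' , a∉X) = only-right oa ¬oa in
                 adj , oa'' , neighbour-in-t'' adj oa'' a∉X , λ (a∈ , b∈) → ¬both (t''→X a∈ , t''→X b∈)
  ... | yes oa' = let (ob'' , b∉X) = only-right ob (λ ob' → ¬left (oa' , ob')) in
                  adj , neighbour-in-t'' (adj-sym G adj) ob'' b∉X , ob'' , λ (a∈ , b∈) → ¬both (t''→X a∈ , t''→X b∈)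

  Combined : Subset n → Subset n → ℕ → Set
  Combined S N k = ∃[ N' ] ∃[ N'' ] ∃[ k' ] ∃[ k'' ]
    (InR G r t' S N' k' × InR G r t'' S N'' k'' × N' ∩ N'' ≡ ∅ × N ≡ N' ∪ N'' × k ≡ k' + k'')

  -- splitting M into its edges in G_t' and the remaining ones, which lie in G_t''
  forward-witness : ∀ {S N k M} → Witness G r (node2 X t' t'') S N k M → Combined S N k
  forward-witness {S} {N} {k} {M} (N⊆S , S⊆X , (matching , good) , k≡ , N≡ , deg) =
    verts G P.A ∩ bag t' , verts G P.B ∩ bag t'' , length P.A , length P.B ,
    witnessed G P.A ((λ m → N⊆S (in-N P.A⊆M t'→X m)) , (λ m → X→t' (S⊆X m)) ,
                     (P.matchingA , All.tabulate λ z → good-down-left (All.lookup good (P.A⊆M z)) (P.P-on-A z)) ,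
                     refl , refl , degenerate-mono G (side P.A⊆M) deg) ,
    witnessed G P.B ((λ m → N⊆S (in-N P.B⊆M t''→X m)) , (λ m → X→t'' (S⊆X m)) ,
                     (P.matchingB , All.tabulate λ z → good-down-right (All.lookup good (P.B⊆M z)) (P.¬P-on-B z)) ,
                     refl , refl , degenerate-mono G (side P.B⊆M) deg) ,
    ext (λ m → let (a , b) = ∩⁻ m in ⊥-elim (P.disjoint (proj₁ (∩⁻ a)) (proj₁ (∩⁻ b)))) (λ m → ⊥-elim (∉⊥ m)) ,
    trans N≡ trace , trans k≡ P.length≡
    where
    module P = Partition (partition in-left? M matching)
    in-N : ∀ {Y Z v} → (∀ {e} → e ∈ₗ Y → e ∈ₗ M) → (v ∈ Z → v ∈ X) → v ∈ verts G Y ∩ Z → v ∈ N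
    in-N Y⊆M Z⊆X m = let (u , w) = ∩⁻ m in ≡∈ (sym N≡) (∩⁺ (verts-mono _ M Y⊆M u) (Z⊆X w))
    side : ∀ {Y} → (∀ {e} → e ∈ₗ Y → e ∈ₗ M) → verts G Y ∪ S ⊆ verts G M ∪ S
    side Y⊆M m = [ (λ u → ∪ˡ (verts-mono _ M Y⊆M u)) , ∪ʳ ]′ (∪⁻ m)
    trace : verts G M ∩ X ≡ (verts G P.A ∩ bag t') ∪ (verts G P.B ∩ bag t'')
    trace = ext (λ m → let (u , w) = ∩⁻ m in
                   [ (λ z → ∪ˡ (∩⁺ z (X→t' w))) , (λ z → ∪ʳ (∩⁺ z (X→t'' w))) ]′
                     (partition-verts (partition in-left? M matching) u))
                (λ m → [ (λ z → let (u , w) = ∩⁻ z in ∩⁺ (verts-mono _ M P.A⊆M u) (t'→X w))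
                       , (λ z → let (u , w) = ∩⁻ z in ∩⁺ (verts-mono _ M P.B⊆M u) (t''→X w)) ]′ (∪⁻ m))

  -- A clique K inside V(M₁) ∪ V(M₂) ∪ S, for matchings M₁ of G_t' and M₂ of
  -- G_t'' whose vertices in X are in S, lies on one side: if some w ∈ K lies
  -- in V(M₂) - V(M₁) - S, then w ∉ X, so every other vertex of K is adjacent to a
  -- vertex of G_t'' - X and lies in G_t''; those in V(M₁) then lie in X, hence in S.
  clique-on-one-side : ∀ {S K M₁ M₂} → All (GoodEdge G t') M₁ → All (GoodEdge G t'') M₂ →
    (∀ {v} → v ∈ verts G M₁ → v ∈ X → v ∈ S) → (∀ {v} → v ∈ verts G M₂ → v ∈ X → v ∈ S) →
    Clique G K → K ⊆ verts G (M₁ ++ M₂) ∪ S → K ⊆ verts G M₁ ∪ S ⊎ K ⊆ verts G M₂ ∪ S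
  clique-on-one-side {S} {K} {M₁} {M₂} good₁ good₂ X₁⊆S X₂⊆S K-clique K⊆ with ⊆-or-witness K (verts G M₁ ∪ S)
  ... | inj₁ K⊆₁ = inj₁ K⊆₁
  ... | inj₂ (w , w∈K , w∉₁) = inj₂ K⊆₂
    where
    w∈M₂ : w ∈ verts G M₂
    w∈M₂ with ∪⁻ (K⊆ w∈K)
    ... | inj₂ w∈S = ⊥-elim (w∉₁ (∪ʳ w∈S))
    ... | inj₁ w∈M = [ (λ z → ⊥-elim (w∉₁ (∪ˡ z))) , (λ z → z) ]′ (verts-++⁻ M₁ M₂ w∈M)
    w∉X : w ∉ X
    w∉X w∈X = w∉₁ (∪ʳ (X₂⊆S w∈M₂ w∈X))
    K⊆₂ : K ⊆ verts G M₂ ∪ S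
    K⊆₂ {u} u∈K with ∪⁻ (K⊆ u∈K)
    ... | inj₂ u∈S = ∪ʳ u∈S
    ... | inj₁ u∈M with verts-++⁻ M₁ M₂ u∈M
    ...   | inj₂ u∈M₂ = ∪ˡ u∈M₂
    ...   | inj₁ u∈M₁ with u ≟ w
    ...     | yes refl = ⊥-elim (w∉₁ (∪ˡ u∈M₁))
    ...     | no u≢w   = ∪ʳ (X₁⊆S u∈M₁ (shared-in-X (matched-occur M₁ good₁ u∈M₁) u-in-t''))
      where
      u-in-t'' : Occurs t'' u
      u-in-t'' = neighbour-in-t'' (K-clique w u w∈K u∈K (λ e → u≢w (sym e))) (matched-occur M₂ good₂ w∈M₂) w∉X

  -- combining M₁ and M₂: their vertex sets are disjoint because N' ∩ N'' = ∅
  -- and X separates G_t' from G_t''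
  backward : ∀ {S N k} → Combined S N k → InR G r (node2 X t' t'') S N k
  backward {S} (N' , N'' , k' , k'' ,
                (N'⊆S , S⊆t' , M₁ , (matching₁ , good₁) , k'≡ , N'≡ , deg₁) ,
                (N''⊆S , _ , M₂ , (matching₂ , good₂) , k''≡ , N''≡ , deg₂) , N'∩N''≡∅ , refl , refl) =
    (λ m → [ N'⊆S , N''⊆S ]′ (∪⁻ m)) , (λ m → t'→X (S⊆t' m)) , M₁ ++ M₂ ,
    (AllPairsProps.++⁺ matching₁ matching₂ cross-disjoint ,
     AllProps.++⁺ (All.map good-left good₁) (All.map good-right good₂)) ,
    trans (cong₂ _+_ k'≡ k''≡) (sym (length-++ M₁)) , trace ,
    small-cliques⇒degenerate small-cliques
    where
    in-N' : ∀ {v} → v ∈ verts G M₁ → v ∈ X → v ∈ N'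
    in-N' u w = ≡∈ (sym N'≡) (∩⁺ u (X→t' w))
    in-N'' : ∀ {v} → v ∈ verts G M₂ → v ∈ X → v ∈ N''
    in-N'' u w = ≡∈ (sym N''≡) (∩⁺ u (X→t'' w))
    cross : ∀ {v} → v ∈ verts G M₁ → v ∈ verts G M₂ → ⊥
    cross u w with ∈X ← shared-in-X (matched-occur M₁ good₁ u) (matched-occur M₂ good₂ w) =
      ∉⊥ (≡∈ N'∩N''≡∅ (∩⁺ (in-N' u ∈X) (in-N'' w ∈X)))
    cross-disjoint : All (λ ed → All (VDisjoint G ed) M₂) M₁
    cross-disjoint = All.tabulate λ ed∈M₁ → let (a∈ , b∈) = edge⇒verts M₁ ed∈M₁ in
      ∉verts⇒disjoint M₂ (cross a∈) (cross b∈)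
    small-cliques : ∀ {K v} → Clique G K → K ⊆ verts G (M₁ ++ M₂) ∪ S → v ∈ K → ∣ K ─ ⁅ v ⁆ ∣ ≤ r
    small-cliques K-clique K⊆ v∈K
      with clique-on-one-side good₁ good₂ (λ u w → N'⊆S (in-N' u w)) (λ u w → N''⊆S (in-N'' u w)) K-clique K⊆
    ... | inj₁ K⊆₁ = clique-bound G K-clique K⊆₁ deg₁ v∈K
    ... | inj₂ K⊆₂ = clique-bound G K-clique K⊆₂ deg₂ v∈K
    trace : N' ∪ N'' ≡ verts G (M₁ ++ M₂) ∩ X
    trace = ext (λ m → [ (λ z → let (u , w) = ∩⁻ (≡∈ N'≡ z) in ∩⁺ (verts-++ˡ M₁ M₂ u) (t'→X w))
                       , (λ z → let (u , w) = ∩⁻ (≡∈ N''≡ z) in ∩⁺ (verts-++ʳ M₁ M₂ u) (t''→X w)) ]′ (∪⁻ m))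
                (λ m → let (u , w) = ∩⁻ m in
                       [ (λ z → ∪ˡ (in-N' z w)) , (λ z → ∪ʳ (in-N'' z w)) ]′ (verts-++⁻ M₁ M₂ u))

  join-R : ∀ S N k → InR G r (node2 X t' t'') S N k ⇔ Combined S N k
  join-R S N k = mk⇔ (λ (N⊆S , S⊆X , M , rest) → forward-witness (N⊆S , S⊆X , rest)) backward

lemma1 : ∀ {n : ℕ} (r : ℕ) (G : Graph n) (T : BTree n) →
    1 ≤ r → Chordal G → NiceCliqueDecomposition G T →
    -- (a) leaves
    (∀ (p : Pos T) X → sub T p ≡ node0 X →
       ∀ S N k → InR G r (node0 X) S N k ⇔ (S ≡ ∅ × N ≡ ∅ × k ≡ 0)) ×
    -- (b) introduce nodes
    (∀ (p : Pos T) X t' x → sub T p ≡ node1 X t' →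
       bag t' ⊆ X → X ─ bag t' ≡ ⁅ x ⁆ →
       ∀ S N k → InR G r (node1 X t') S N k ⇔
         (InR G r t' S N k ⊎
          ∃[ S' ] (InR G r t' S' N k × ∣ S' ∣ ≤ r × S ≡ S' ∪ ⁅ x ⁆))) ×
    -- (c) forget nodes
    (∀ (p : Pos T) X t' x → sub T p ≡ node1 X t' →
       X ⊆ bag t' → bag t' ─ X ≡ ⁅ x ⁆ →
       ∀ S N k → InR G r (node1 X t') S N k ⇔
         ((InR G r t' S N k × x ∉ S) ⊎
          (∃[ S' ] ∃[ N' ] ∃[ k' ] ∃[ y ]
             (InR G r t' S' N' k' × x ∈ S' × x ∉ N' ×
              y ∈ S' × y ∉ N' × y ≢ x ×
              S ≡ S' ─ ⁅ x ⁆ × N ≡ N' ∪ ⁅ y ⁆ × k ≡ suc k')) ⊎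
          (∃[ S' ] ∃[ N' ] ∃[ k' ]
             (InR G r t' S' N' k' × x ∈ N' ×
              S ≡ S' ─ ⁅ x ⁆ × N ≡ N' ─ ⁅ x ⁆ × k ≡ k')))) ×
    -- (d) join nodes
    (∀ (p : Pos T) X t' t'' → sub T p ≡ node2 X t' t'' →
       ∀ S N k → InR G r (node2 X t' t'') S N k ⇔
         (∃[ N' ] ∃[ N'' ] ∃[ k' ] ∃[ k'' ]
            (InR G r t' S N' k' × InR G r t'' S N'' k'' ×
             N' ∩ N'' ≡ ∅ × N ≡ N' ∪ N'' × k ≡ k' + k'')))
lemma1 r G T _ _ D =
  (λ p X e → leaf-R r G (subst (NodeOK G) e (node-ok p))) ,
  (λ p X t' x e t'⊆X X─t'≡x → Introduce.introduce-R r G T D p X t' x e t'⊆X X─t'≡x) ,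
  (λ p X t' x e X⊆t' t'─X≡x → Forget.forget-R r G X t' x (child-clique p e) X⊆t' t'─X≡x) ,
  (λ p X t' t'' e → Join.join-R r G T D p X t' t'' e)
  where open Decomposition G T D
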